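{- For all words $u,v\in\{0,1\}^*$ (finite, possibly empty words over $\{0,1\}$), the following identities hold in $\mathbb Z[a,b,q]$: $$[u10v]=q[u01v]+[u1v]+[u0v],\qquad [0v]=a[v],\qquad [u1]=b[u].$$
   Context: An alternative tree on a finite nonempty totally ordered set $S$ is an unordered rooted tree with vertex set $S$ such that (i) the root is $\min S$ or $\max S$; (ii) if a vertex is larger than its parent, it is larger than all of its descendants; (iii) if a vertex is smaller than its parent, it is smaller than all of its descendants. For $n\ge0$ let $\mathcal O_n$ be the set of alternative trees on $\{0,1,\ldots,n+1\}$ with root $0$. For $\mathcal T\in\mathcal O_n$ let $p(i)$ denote the parent of a non-root vertex $i$; $i$ is an excedance if $i<p(i)$; $\mathcal X(\mathcal T)\in\{0,1\}^n$ has $\mathcal X(\mathcal T)(i)=1$ iff $i\in\{1,\ldots,n\}$ is an excedance; $\mathrm{yy}(\mathcal T)$ is the number of pairs $1\le i<j\le n$ with $p(j)<i<j<p(i)$; $c_0(\mathcal T)$ is the number of children of $0$ and $c_1(\mathcal T)$ the number of children of $n+1$. For $a,b,q$ indeterminates and a word $\eta\in\{0,1\}^n$ (identified with an element of $\{0,1\}^n$), define $$[\eta]=\sum a^{c_0(\mathcal T)}b^{c_1(\mathcal T)}q^{\mathrm{yy}(\mathcal T)},$$ the sum over all $\mathcal T\in\bigcup_{n\ge0}\mathcal O_n$ with $\mathcal X(\mathcal T)=\eta$. -}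

module Defs where

open import Data.Bool using (Bool; true; false; _∧_; _∨_; not; if_then_else_)
open import Data.Nat using (ℕ; zero; suc; _+_; _∸_; _<ᵇ_; _≡ᵇ_)
open import Data.List using (List; []; _∷_; map; concatMap; upTo; length; filterᵇ)
open import Data.Bool.ListAction using (all; any)
open import Data.Product using (_×_)

-- Vertices are 0,1,...,n+1, root 0.  A tree is encoded by its parent
-- function on the non-root vertices 1..n+1, as a list ps of length n+1
-- with ps[i-1] = p(i) ∈ {0,...,n+1}.  (An unordered rooted tree on a
-- fixed vertex set with fixed root is the same thing as such a parent
-- function in which every vertex eventually reaches the root.)

from1 : ℕ → List ℕ
from1 m = map suc (upTo m)

vecs : ℕ → ℕ → List (List ℕ)
vecs zero    k = [] ∷ []
vecs (suc m) k = concatMap (λ x → map (x ∷_) (vecs m k)) (upTo k)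

at : List ℕ → ℕ → ℕ
at []       _       = 0
at (x ∷ xs) zero    = x
at (x ∷ xs) (suc i) = at xs i

-- parent of vertex i (meaningful for 1 ≤ i ≤ n+1)
par : List ℕ → ℕ → ℕ
par ps zero    = 0
par ps (suc i) = at ps i

iter : List ℕ → ℕ → ℕ → ℕ
iter ps zero    i = i
iter ps (suc k) i = par ps (iter ps k i)

reachesRoot : ℕ → List ℕ → ℕ → Bool
reachesRoot n ps i = any (λ k → iter ps k i ≡ᵇ 0) (upTo (n + 3))

isTree : ℕ → List ℕ → Bool
isTree n ps = all (reachesRoot n ps) (from1 (suc n))

isDesc : ℕ → List ℕ → ℕ → ℕ → Bool
isDesc n ps d i = any (λ k → iter ps (suc k) d ≡ᵇ i) (upTo (n + 3))

-- (ii) and (iii) of the definition of an alternative tree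
-- (the root 0 = min S, so (i) holds automatically)
isAlternative : ℕ → List ℕ → Bool
isAlternative n ps = all cond (from1 (suc n))
  where
  cond : ℕ → Bool
  cond i = all (λ d → if isDesc n ps d i
                        then ((if par ps i <ᵇ i then d <ᵇ i else true)
                             ∧ (if i <ᵇ par ps i then i <ᵇ d else true))
                        else true)
               (from1 (suc n))

-- X(T) ∈ {0,1}^n as a word of Booleans (true = 1): position i ↦ [i < p(i)]
excWord : ℕ → List ℕ → List Bool
excWord n ps = map (λ i → i <ᵇ par ps i) (from1 n)

children : ℕ → List ℕ → ℕ → ℕ
children n ps v = length (filterᵇ (λ i → par ps i ≡ᵇ v) (from1 (suc n)))

c0 : ℕ → List ℕ → ℕ
c0 n ps = children n ps 0

c1 : ℕ → List ℕ → ℕ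
c1 n ps = children n ps (suc n)

yy : ℕ → List ℕ → ℕ
yy n ps = length (filterᵇ (λ ij → pr ij) (concatMap (λ j → map (λ i → i ∷ j ∷ []) (from1 n)) (from1 n)))
  where
  pr : List ℕ → Bool
  pr (i ∷ j ∷ []) = (par ps j <ᵇ i) ∧ (i <ᵇ j) ∧ (j <ᵇ par ps i)
  pr _            = false

eqBools : List Bool → List Bool → Bool
eqBools []          []          = true
eqBools (x ∷ xs)    (y ∷ ys)    = (if x then y else not y) ∧ eqBools xs ys
eqBools _           _           = false

-- Polynomials in a, b, q (with natural-number coefficients, which is all
-- that occurs here) represented by their coefficient function:
-- P i j k = coefficient of a^i b^j q^k.

Poly : Set
Poly = ℕ → ℕ → ℕ → ℕ

_+P_ : Poly → Poly → Poly
(P +P Q) i j k = P i j k + Q i j k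
infixl 6 _+P_

mulA : Poly → Poly
mulA P zero    j k = 0
mulA P (suc i) j k = P i j k

mulB : Poly → Poly
mulB P i zero    k = 0
mulB P i (suc j) k = P i j k

mulQ : Poly → Poly
mulQ P i j zero    = 0
mulQ P i j (suc k) = P i j k

open import Relation.Binary.PropositionalEquality using (_≡_)

_≈P_ : Poly → Poly → Set
P ≈P Q = ∀ i j k → P i j k ≡ Q i j k
infix 4 _≈P_

-- [η]: coefficient of a^i b^j q^k is the number of alternative trees T
-- in O_n (n = |η|) with X(T) = η, c0 = i, c1 = j, yy = k.
bracket : List Bool → Poly
bracket η i j k = length (filterᵇ ok (vecs (suc n) (n + 2)))
  where
  n = length η
  ok : List ℕ → Bool
  ok ps = isTree n ps ∧ isAlternative n ps ∧ eqBools (excWord n ps) η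
          ∧ (c0 n ps ≡ᵇ i) ∧ (c1 n ps ≡ᵇ j) ∧ (yy n ps ≡ᵇ k)

module Submission where

-- Renaming the vertices by the shift σ ℓ and hanging a
--    new leaf ℓ from a neighbour q of ℓ is a bijection onto the trees where
--    ℓ is such a leaf; it inserts one letter into the word, adds a child to
--    q, and leaves yy unchanged (LeafInsertion).
--  * Label exchange.  Exchanging k and k+1 when they are unrelated swaps the
--    letters at k, k+1 and changes yy by exactly one (CrossingPairs,
--    AdjacentSwap).
--  * Identities.  [0v] = a[v] and [u1] = b[u] delete a leaf; [u10v] splits
--    into three classes treated by deletion (twice) and by exchange.

open import Defs
open import Data.Bool using (Bool; true; false; _∧_; not; if_then_else_; T)
open import Data.Bool.Properties using (T?; ∧-identityʳ; ∧-zeroʳ; ∧-assoc)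
open import Data.Bool.ListAction using (all; any)
open import Data.Empty using (⊥; ⊥-elim)
open import Data.Fin using (Fin; toℕ; fromℕ<)
import Data.Fin.Properties as FP
open import Data.List using (List; []; _∷_; _++_; map; concatMap; upTo; length; filterᵇ; applyUpTo)
open import Data.List.Properties using (length-map; map-∘; map-applyUpTo; length-applyUpTo; length-++; ++-assoc; ++-identityʳ; map-++)
open import Data.List.Membership.Propositional using (_∈_)
open import Data.List.Membership.Propositional.Properties
open import Data.List.Membership.Propositional.Properties.WithK using (unique∧set⇒bag)
open import Data.List.Relation.Binary.BagAndSetEquality using (∼bag⇒↭)
open import Data.List.Relation.Binary.Disjoint.Propositional using (Disjoint)
open import Data.List.Relation.Binary.Permutation.Propositional using (_↭_)
open import Data.List.Relation.Binary.Permutation.Propositional.Properties using (↭-length)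
import Data.List.Relation.Binary.Permutation.Propositional.Properties as PP
open import Data.List.Relation.Unary.All using (All; []; _∷_)
open import Data.List.Relation.Unary.AllPairs using ([]; _∷_)
open import Data.List.Relation.Unary.Any using (Any; here; there)
open import Data.List.Relation.Unary.Unique.Propositional using (Unique)
import Data.List.Relation.Unary.Unique.Propositional.Properties as UP
open import Data.Nat
open import Data.Nat.Properties
open import Data.Nat.Induction using (<-rec)
open import Data.Nat.ListAction using (sum)
open import Data.Nat.ListAction.Properties using (sum-↭; sum-++)
open import Data.Product using (∃; _×_; _,_; proj₁; proj₂)
open import Data.Sum using (_⊎_; inj₁; inj₂)
open import Function.Bundles using (mk⇔)
open import Relation.Binary.Definitions using (tri<; tri≈; tri>)
open import Relation.Binary.PropositionalEquality
open import Relation.Nullary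

𝟙 : Bool → ℕ
𝟙 true  = 1
𝟙 false = 0

T→≡ : ∀ {b} → T b → b ≡ true
T→≡ {true} _ = refl

≡→T : ∀ {b} → b ≡ true → T b
≡→T refl = _

false≢true : false ≢ true
false≢true ()

all-∈ : ∀ {A : Set} (P : A → Bool) (xs : List A) → all P xs ≡ true → ∀ {x} → x ∈ xs → P x ≡ true
all-∈ P (y ∷ xs) h (here refl) with P y
... | true  = refl
... | false = h
all-∈ P (y ∷ xs) h (there m) with P y
... | true  = all-∈ P xs h m
... | false = ⊥-elim (false≢true h)

∈-all : ∀ {A : Set} (P : A → Bool) (xs : List A) → (∀ {x} → x ∈ xs → P x ≡ true) → all P xs ≡ true
∈-all P []       h = refl
∈-all P (y ∷ xs) h rewrite h (here refl) = ∈-all P xs (λ m → h (there m))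

any-∈ : ∀ {A : Set} (P : A → Bool) (xs : List A) → any P xs ≡ true → ∃ λ x → x ∈ xs × P x ≡ true
any-∈ P (y ∷ xs) h with P y in eq
... | true  = y , here refl , eq
... | false = let (x , m , e) = any-∈ P xs h in x , there m , e

∈-any : ∀ {A : Set} (P : A → Bool) (xs : List A) → ∀ {x} → x ∈ xs → P x ≡ true → any P xs ≡ true
∈-any P (y ∷ xs) (here refl) e rewrite e = refl
∈-any P (y ∷ xs) (there m) e with P y
... | true  = refl
... | false = ∈-any P xs m e

∈-filterᵇ⁺ : ∀ {A : Set} (P : A → Bool) {xs x} → x ∈ xs → P x ≡ true → x ∈ filterᵇ P xs
∈-filterᵇ⁺ P m e = ∈-filter⁺ (λ x → T? (P x)) m (≡→T e)

∈-filterᵇ⁻ : ∀ {A : Set} (P : A → Bool) {xs x} → x ∈ filterᵇ P xs → x ∈ xs × P x ≡ true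
∈-filterᵇ⁻ P m = let (a , b) = ∈-filter⁻ (λ x → T? (P x)) m in a , T→≡ b

∈-from1⁺ : ∀ {m x} → 1 ≤ x → x ≤ m → x ∈ from1 m
∈-from1⁺ {m} {suc x} (s≤s z≤n) x≤m = ∈-map⁺ suc (∈-upTo⁺ x≤m)

∈-from1⁻ : ∀ {m x} → x ∈ from1 m → 1 ≤ x × x ≤ m
∈-from1⁻ {m} mem with ∈-map⁻ suc mem
... | y , ym , refl = s≤s z≤n , ∈-upTo⁻ ym

length-filter : ∀ {A : Set} (P : A → Bool) (xs : List A) → length (filterᵇ P xs) ≡ sum (map (λ x → 𝟙 (P x)) xs)
length-filter P []       = refl
length-filter P (x ∷ xs) with P x
... | true  = cong suc (length-filter P xs)
... | false = length-filter P xs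

sum-concatMap : ∀ {A B : Set} (f : A → List B) (g : B → ℕ) (xs : List A) →
  sum (map g (concatMap f xs)) ≡ sum (map (λ x → sum (map g (f x))) xs)
sum-concatMap f g []       = refl
sum-concatMap f g (x ∷ xs) rewrite map-++ g (f x) (concatMap f xs)
  | sum-++ (map g (f x)) (map g (concatMap f xs)) | sum-concatMap f g xs = refl

sum-map-cong : ∀ {A : Set} (f g : A → ℕ) (xs : List A) → (∀ {x} → x ∈ xs → f x ≡ g x) → sum (map f xs) ≡ sum (map g xs)
sum-map-cong f g []       h = refl
sum-map-cong f g (x ∷ xs) h = cong₂ _+_ (h (here refl)) (sum-map-cong f g xs (λ m → h (there m)))

sum-map-+ : ∀ {A : Set} (f g : A → ℕ) (xs : List A) → sum (map (λ x → f x + g x) xs) ≡ sum (map f xs) + sum (map g xs)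
sum-map-+ f g []       = refl
sum-map-+ f g (x ∷ xs) rewrite sum-map-+ f g xs = +-interchange (f x) (g x) (sum (map f xs)) (sum (map g xs))
  where
  +-interchange : ∀ a b c d → a + b + (c + d) ≡ a + c + (b + d)
  +-interchange a b c d rewrite +-assoc a b (c + d) | +-assoc a c (b + d)
    | sym (+-assoc b c d) | +-comm b c | +-assoc c b d = refl

sum-zeros : ∀ {A : Set} (xs : List A) → sum (map (λ _ → 0) xs) ≡ 0
sum-zeros []       = refl
sum-zeros (x ∷ xs) = sum-zeros xs

bag : ∀ {A : Set} {xs ys : List A} → Unique xs → Unique ys →
  (∀ {x} → x ∈ xs → x ∈ ys) → (∀ {x} → x ∈ ys → x ∈ xs) → xs ↭ ys
bag ux uy f g = ∼bag⇒↭ (unique∧set⇒bag ux uy (mk⇔ f g))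

uniq-map : ∀ {A B : Set} (f : A → B) (xs : List A) →
  (∀ {x y} → x ∈ xs → y ∈ xs → f x ≡ f y → x ≡ y) → Unique xs → Unique (map f xs)
uniq-map f []       inj u       = []
uniq-map f (x ∷ xs) inj (a ∷ u) = fresh xs a (λ m → there m) ∷ uniq-map f xs (λ mx my → inj (there mx) (there my)) u
  where
  fresh : ∀ ys → All (λ y → ¬ x ≡ y) ys → (∀ {y} → y ∈ ys → y ∈ x ∷ xs) → All (λ z → ¬ f x ≡ z) (map f ys)
  fresh []       _          _   = []
  fresh (y ∷ ys) (ne ∷ nes) sub = (λ e → ne (inj (here refl) (sub (here refl)) e)) ∷ fresh ys nes (λ m → sub (there m))

uniq-filter : ∀ {A : Set} (P : A → Bool) {xs : List A} → Unique xs → Unique (filterᵇ P xs)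
uniq-filter P u = UP.filter⁺ (λ x → T? (P x)) u

uniq-from1 : ∀ m → Unique (from1 m)
uniq-from1 m = UP.map⁺ suc-injective (UP.upTo⁺ m)

count-bij : ∀ {A : Set} {xs ys : List A} (P Q : A → Bool) (f g : A → A) → Unique xs → Unique ys →
  (∀ x → x ∈ xs → P x ≡ true → f x ∈ ys × Q (f x) ≡ true × g (f x) ≡ x) →
  (∀ y → y ∈ ys → Q y ≡ true → g y ∈ xs × P (g y) ≡ true × f (g y) ≡ y) →
  length (filterᵇ P xs) ≡ length (filterᵇ Q ys)
count-bij {xs = xs} {ys} P Q f g ux uy to01 from01 =
  trans (sym (length-map f FP)) (↭-length (bag (uniq-map f FP inj (uniq-filter P ux)) (uniq-filter Q uy) to from))
  where
  FP = filterᵇ P xs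
  FQ = filterᵇ Q ys
  inj : ∀ {x y} → x ∈ FP → y ∈ FP → f x ≡ f y → x ≡ y
  inj {x} {y} mx my e =
    let (mx1 , px) = ∈-filterᵇ⁻ P mx
        (my1 , py) = ∈-filterᵇ⁻ P my
    in trans (sym (proj₂ (proj₂ (to01 x mx1 px)))) (trans (cong g e) (proj₂ (proj₂ (to01 y my1 py))))
  to : ∀ {x} → x ∈ map f FP → x ∈ FQ
  to mm with ∈-map⁻ f mm
  ... | y , my , refl = let (my1 , py) = ∈-filterᵇ⁻ P my
                            (a , b , _) = to01 y my1 py in ∈-filterᵇ⁺ Q a b
  from : ∀ {x} → x ∈ FQ → x ∈ map f FP
  from {x} mm = let (mx1 , qx) = ∈-filterᵇ⁻ Q mm
                    (a , b , c) = from01 x mx1 qx in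
                subst (_∈ map f FP) c (∈-map⁺ f (∈-filterᵇ⁺ P a b))

count-split : ∀ {A : Set} (P C : A → Bool) (xs : List A) →
  length (filterᵇ P xs) ≡ length (filterᵇ (λ x → P x ∧ C x) xs) + length (filterᵇ (λ x → P x ∧ not (C x)) xs)
count-split P C []       = refl
count-split P C (x ∷ xs) with P x | C x
... | true  | true  = cong suc (count-split P C xs)
... | true  | false = trans (cong suc (count-split P C xs)) (sym (+-suc _ _))
... | false | _     = count-split P C xs

count-zero-∈ : ∀ {A : Set} (P : A → Bool) (xs : List A) → (∀ {x} → x ∈ xs → P x ≡ false) → length (filterᵇ P xs) ≡ 0
count-zero-∈ P []       h = refl
count-zero-∈ P (x ∷ xs) h rewrite h (here refl) = count-zero-∈ P xs (λ m → h (there m))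

count-cong : ∀ {A : Set} (P Q : A → Bool) (xs : List A) → (∀ {x} → x ∈ xs → P x ≡ Q x) → length (filterᵇ P xs) ≡ length (filterᵇ Q xs)
count-cong P Q []       h = refl
count-cong P Q (x ∷ xs) h with P x | Q x | h (here refl)
... | true  | true  | _ = cong suc (count-cong P Q xs (λ m → h (there m)))
... | false | false | _ = count-cong P Q xs (λ m → h (there m))

data Bounded (k : ℕ) : List ℕ → Set where
  []  : Bounded k []
  _∷_ : ∀ {x xs} → x < k → Bounded k xs → Bounded k (x ∷ xs)

∈-vecs⁺ : ∀ m k ps → length ps ≡ m → Bounded k ps → ps ∈ vecs m k
∈-vecs⁺ zero    k []       refl []          = here refl
∈-vecs⁺ (suc m) k (x ∷ ps) refl (x<k ∷ b) =
  ∈-concatMap⁺ (λ y → map (y ∷_) (vecs m k)) (choose (upTo k) (∈-upTo⁺ x<k))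
  where
  choose : ∀ ys → x ∈ ys → Any (λ y → (x ∷ ps) ∈ map (y ∷_) (vecs m k)) ys
  choose (y ∷ ys) (here refl) = here (∈-map⁺ (x ∷_) (∈-vecs⁺ m k ps refl b))
  choose (y ∷ ys) (there mm)  = there (choose ys mm)

∈-vecs⁻ : ∀ m k ps → ps ∈ vecs m k → length ps ≡ m × Bounded k ps
∈-vecs⁻ zero    k ps (here refl) = refl , []
∈-vecs⁻ (suc m) k ps mm = chosen (upTo k) ∈-upTo⁻ (∈-concatMap⁻ (λ y → map (y ∷_) (vecs m k)) mm)
  where
  chosen : ∀ ys → (∀ {y} → y ∈ ys → y < k) → Any (λ y → ps ∈ map (y ∷_) (vecs m k)) ys → length ps ≡ suc m × Bounded k ps
  chosen (y ∷ ys) bd (here m2) with ∈-map⁻ (y ∷_) m2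
  ... | qs , qm , refl = let (l , b) = ∈-vecs⁻ m k qs qm in cong suc l , bd (here refl) ∷ b
  chosen (y ∷ ys) bd (there m2) = chosen ys (λ z → bd (there z)) m2

uniq-vecs : ∀ m k → Unique (vecs m k)
uniq-vecs zero    k = [] ∷ []
uniq-vecs (suc m) k = block (upTo k) (UP.upTo⁺ k)
  where
  prefixed : ℕ → List (List ℕ)
  prefixed y = map (y ∷_) (vecs m k)
  block : ∀ ys → Unique ys → Unique (concatMap prefixed ys)
  block []       _       = []
  block (y ∷ ys) (a ∷ u) = UP.++⁺ (UP.map⁺ (λ { refl → refl }) (uniq-vecs m k)) (block ys u) disjoint
    where
    disjoint : Disjoint (prefixed y) (concatMap prefixed ys)
    disjoint (m1 , m2) with ∈-map⁻ (y ∷_) m1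
    ... | qs , _ , refl = differentHead ys a (∈-concatMap⁻ prefixed m2)
      where
      differentHead : ∀ zs → All (λ z → ¬ y ≡ z) zs → Any (λ z → (y ∷ qs) ∈ prefixed z) zs → ⊥
      differentHead (z ∷ zs) (ne ∷ _) (here m3) with ∈-map⁻ (z ∷_) m3
      ... | _ , _ , refl = ne refl
      differentHead (z ∷ zs) (_ ∷ nes) (there m3) = differentHead zs nes m3

∧-split : ∀ {a b} → a ∧ b ≡ true → a ≡ true × b ≡ true
∧-split {true} {true} _ = refl , refl

∧-join : ∀ {a b} → a ≡ true → b ≡ true → a ∧ b ≡ true
∧-join refl refl = refl

if-use : ∀ {b c} → (if b then c else true) ≡ true → b ≡ true → c ≡ true
if-use {true} h refl = h

if-mk : ∀ {b c} → (b ≡ true → c ≡ true) → (if b then c else true) ≡ true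
if-mk {true}  h = h refl
if-mk {false} h = refl

<ᵇ→ : ∀ {m n} → (m <ᵇ n) ≡ true → m < n
<ᵇ→ {m} {n} e = <ᵇ⇒< m n (≡→T e)

→<ᵇ : ∀ {m n} → m < n → (m <ᵇ n) ≡ true
→<ᵇ {m} {n} l = T→≡ (<⇒<ᵇ l)

≡ᵇ→ : ∀ {m n} → (m ≡ᵇ n) ≡ true → m ≡ n
≡ᵇ→ {m} {n} e = ≡ᵇ⇒≡ m n (≡→T e)

→≡ᵇ : ∀ {m n} → m ≡ n → (m ≡ᵇ n) ≡ true
→≡ᵇ {m} {n} e = T→≡ (≡⇒≡ᵇ m n e)

<ᵇ-f : ∀ {a b} → b ≤ a → (a <ᵇ b) ≡ false
<ᵇ-f {a} {b} b≤a with a <ᵇ b in e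
... | true  = ⊥-elim (<⇒≱ (<ᵇ→ e) b≤a)
... | false = refl

<ᵇ-dec : ∀ a b → ((a <ᵇ b) ≡ true × a < b) ⊎ ((a <ᵇ b) ≡ false × b ≤ a)
<ᵇ-dec a b with a <? b
... | yes lt = inj₁ (→<ᵇ lt , lt)
... | no nlt = inj₂ (<ᵇ-f (≮⇒≥ nlt) , ≮⇒≥ nlt)

<ᵇ-irrefl : ∀ x → (x <ᵇ x) ≡ false
<ᵇ-irrefl x = <ᵇ-f {x} {x} ≤-refl

<ᵇ-≡ : ∀ {a b c d} → (a < b → c < d) → (c < d → a < b) → (a <ᵇ b) ≡ (c <ᵇ d)
<ᵇ-≡ {a} {b} to from with a <? b
... | yes a<b = trans (→<ᵇ a<b) (sym (→<ᵇ (to a<b)))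
... | no  a≮b = trans (<ᵇ-f (≮⇒≥ a≮b)) (sym (<ᵇ-f (≮⇒≥ (λ c<d → a≮b (from c<d)))))

≡ᵇ-f : ∀ {a b} → a ≢ b → (a ≡ᵇ b) ≡ false
≡ᵇ-f {a} {b} ne with a ≡ᵇ b in e
... | true  = ⊥-elim (ne (≡ᵇ→ e))
... | false = refl

≡ᵇ-refl : ∀ a → (a ≡ᵇ a) ≡ true
≡ᵇ-refl a = →≡ᵇ {a} {a} refl

≡ᵇ-inj : ∀ (f : ℕ → ℕ) → (∀ {a b} → f a ≡ f b → a ≡ b) → ∀ a b → (f a ≡ᵇ f b) ≡ (a ≡ᵇ b)
≡ᵇ-inj f inj a b with a ≟ b
... | yes refl = trans (≡ᵇ-refl (f a)) (sym (≡ᵇ-refl a))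
... | no  ne   = trans (≡ᵇ-f (λ e → ne (inj e))) (sym (≡ᵇ-f ne))

∧-false₁ : ∀ {a} b c → a ≡ false → (a ∧ b ∧ c) ≡ false
∧-false₁ b c refl = refl

∧-false₂ : ∀ a {b} c → b ≡ false → (a ∧ b ∧ c) ≡ false
∧-false₂ false c refl = refl
∧-false₂ true  c refl = refl

∧-false₃ : ∀ a b {c} → c ≡ false → (a ∧ b ∧ c) ≡ false
∧-false₃ false b     refl = refl
∧-false₃ true  false refl = refl
∧-false₃ true  true  refl = refl

not-true : ∀ {b} → not b ≡ true → b ≡ false
not-true {false} _ = refl

≡ᵇ-false⇒≢ : ∀ {x y} → (x ≡ᵇ y) ≡ false → x ≢ y
≡ᵇ-false⇒≢ h e = false≢true (trans (sym h) (→≡ᵇ e))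

tab : ℕ → (ℕ → ℕ) → List ℕ
tab m F = applyUpTo (λ i → F (suc i)) m

at-applyUpTo : ∀ (g : ℕ → ℕ) n i → i < n → at (applyUpTo g n) i ≡ g i
at-applyUpTo g (suc n) zero    _         = refl
at-applyUpTo g (suc n) (suc i) (s≤s i<n) = at-applyUpTo (λ j → g (suc j)) n i i<n

par-tab : ∀ m F i → 1 ≤ i → i ≤ m → par (tab m F) i ≡ F i
par-tab m F (suc i) _ i≤m = at-applyUpTo (λ j → F (suc j)) m i i≤m

length-tab : ∀ m F → length (tab m F) ≡ m
length-tab m F = length-applyUpTo _ m

bounded-tab : ∀ m k F → (∀ i → 1 ≤ i → i ≤ m → F i < k) → Bounded k (tab m F)
bounded-tab m k F h = go m (λ i → F (suc i)) (λ i i<m → h (suc i) (s≤s z≤n) i<m)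
  where
  go : ∀ m (g : ℕ → ℕ) → (∀ i → i < m → g i < k) → Bounded k (applyUpTo g m)
  go zero    g h = []
  go (suc m) g h = h 0 (s≤s z≤n) ∷ go m (λ i → g (suc i)) (λ i i<m → h (suc i) (s≤s i<m))

tab-cong : ∀ m F G → (∀ i → 1 ≤ i → i ≤ m → F i ≡ G i) → tab m F ≡ tab m G
tab-cong m F G h = go m (λ i → F (suc i)) (λ i → G (suc i)) (λ i i<m → h (suc i) (s≤s z≤n) i<m)
  where
  go : ∀ m (f g : ℕ → ℕ) → (∀ i → i < m → f i ≡ g i) → applyUpTo f m ≡ applyUpTo g m
  go zero    f g h = refl
  go (suc m) f g h = cong₂ _∷_ (h 0 (s≤s z≤n)) (go m _ _ (λ i i<m → h (suc i) (s≤s i<m)))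

tab-par : ∀ ps → ps ≡ tab (length ps) (par ps)
tab-par []       = refl
tab-par (x ∷ ps) = cong (x ∷_) (tab-par ps)

par-≤ : ∀ k ps → Bounded (suc k) ps → ∀ x → par ps x ≤ k
par-≤ k ps b zero    = z≤n
par-≤ k ps b (suc x) = go ps b x
  where
  go : ∀ ps → Bounded (suc k) ps → ∀ x → at ps x ≤ k
  go []       []        x       = z≤n
  go (y ∷ ps) (y<k ∷ b) zero    = ≤-pred y<k
  go (y ∷ ps) (y<k ∷ b) (suc x) = go ps b x

par-out : ∀ ps x → length ps < x → par ps x ≡ 0
par-out ps       zero          _       = refl
par-out []       (suc x)       _       = refl
par-out (y ∷ ps) (suc (suc x)) (s≤s l) = par-out ps (suc x) l

Shape : ℕ → List ℕ → Set
Shape n ps = length ps ≡ suc n × Bounded (suc (suc n)) ps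

shape-par : ∀ n ps → Shape n ps → ∀ x → par ps x ≤ suc n
shape-par n ps (_ , b) = par-≤ (suc n) ps b

child-range : ∀ n ps → Shape n ps → ∀ x c → par ps x ≡ c → 1 ≤ c → 1 ≤ x × x ≤ suc n
child-range n ps v zero    c e l = ⊥-elim (<-irrefl e l)
child-range n ps v (suc x) c e l with suc x ≤? suc n
... | yes le = s≤s z≤n , le
... | no nle = ⊥-elim (<-irrefl (trans (sym (par-out ps (suc x) (subst (_< suc x) (sym (proj₁ v)) (≰⇒> nle)))) e) l)

iterF : (ℕ → ℕ) → ℕ → ℕ → ℕ
iterF p zero    x = x
iterF p (suc k) x = p (iterF p k x)

iter≡ : ∀ ps k x → iter ps k x ≡ iterF (par ps) k x
iter≡ ps zero    x = refl
iter≡ ps (suc k) x = cong (par ps) (iter≡ ps k x)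

iter-+ : ∀ p c a x → iterF p (c + a) x ≡ iterF p c (iterF p a x)
iter-+ p zero    a x = refl
iter-+ p (suc c) a x = cong p (iter-+ p c a x)

iter-suc : ∀ p k x → iterF p (suc k) x ≡ iterF p k (p x)
iter-suc p zero    x = refl
iter-suc p (suc k) x = cong p (iter-suc p k x)

iter-≤ : ∀ p n → (∀ x → p x ≤ n) → ∀ k x → x ≤ n → iterF p k x ≤ n
iter-≤ p n h zero    x x≤ = x≤
iter-≤ p n h (suc k) x x≤ = h _

iter-fixed : ∀ p x → p x ≡ x → ∀ k → iterF p k x ≡ x
iter-fixed p x e zero    = refl
iter-fixed p x e (suc k) = trans (cong p (iter-fixed p x e k)) e

Reach : (ℕ → ℕ) → ℕ → ℕ → Set
Reach p x y = ∃ λ k → iterF p k x ≡ y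

Reach-step : ∀ {p y i} → y ≢ i → Reach p y i → Reach p (p y) i
Reach-step             ne (zero , e)  = ⊥-elim (ne e)
Reach-step {p} {y} {i} ne (suc j , e) = j , trans (sym (iter-suc p j y)) e

-- Pigeonhole: if p maps into {0..n}, a path of length k > n from x ≤ n
-- revisits a vertex, so the same endpoint is reached by a shorter path.
shortcut : ∀ p n → (∀ x → p x ≤ n) → ∀ x → x ≤ n → ∀ k y → n < k → iterF p k x ≡ y →
           ∃ λ k' → k' < k × iterF p k' x ≡ y
shortcut p n h x x≤ k y n<k e =
  let (i , j , i<j , same) = FP.pigeonhole (n<1+n (suc n)) visit
      c = k ∸ toℕ j
      k≡ : k ≡ c + toℕ j
      k≡ = sym (m∸n+n≡m (≤-trans (≤-pred (FP.toℕ<n j)) n<k))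
      loop : iterF p (toℕ i) x ≡ iterF p (toℕ j) x
      loop = trans (sym (FP.toℕ-fromℕ< (bound (toℕ i))))
               (trans (cong toℕ same) (FP.toℕ-fromℕ< (bound (toℕ j))))
  in c + toℕ i , subst (c + toℕ i <_) (sym k≡) (+-monoʳ-< c i<j)
   , (begin
       iterF p (c + toℕ i) x      ≡⟨ iter-+ p c (toℕ i) x ⟩
       iterF p c (iterF p (toℕ i) x) ≡⟨ cong (iterF p c) loop ⟩
       iterF p c (iterF p (toℕ j) x) ≡⟨ sym (iter-+ p c (toℕ j) x) ⟩
       iterF p (c + toℕ j) x      ≡⟨ cong (λ z → iterF p z x) (sym k≡) ⟩
       iterF p k x                ≡⟨ e ⟩
       y                          ∎)
  where
  open ≡-Reasoning
  bound : ∀ a → iterF p a x < suc n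
  bound a = s≤s (iter-≤ p n h a x x≤)
  visit : Fin (suc (suc n)) → Fin (suc n)
  visit i = fromℕ< (bound (toℕ i))

short-path : ∀ p n → (∀ x → p x ≤ n) → ∀ x → x ≤ n → ∀ {y} → Reach p x y → ∃ λ k → k ≤ n × iterF p k x ≡ y
short-path p n h x x≤ (k , e) = <-rec Goal step k e
  where
  Goal : ℕ → Set
  Goal k = iterF p k x ≡ _ → ∃ λ k' → k' ≤ n × iterF p k' x ≡ _
  step : ∀ k → (∀ {k'} → k' < k → Goal k') → Goal k
  step k rec e with k ≤? n
  ... | yes k≤n = k , k≤n , e
  ... | no  k≰n = let (k' , k'<k , e') = shortcut p n h x x≤ k _ (≰⇒> k≰n) e in rec k'<k e'

n+2≤n+3 : ∀ n → suc (suc n) ≤ n + 3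
n+2≤n+3 n = ≤-trans (n≤1+n _) (≤-reflexive (+-comm 3 n))

reach⇒ : ∀ n ps x → reachesRoot n ps x ≡ true → Reach (par ps) x 0
reach⇒ n ps x h = let (k , _ , e) = any-∈ _ (upTo (n + 3)) h in k , trans (sym (iter≡ ps k x)) (≡ᵇ→ e)

reach⇐ : ∀ n ps → Shape n ps → ∀ x → x ≤ suc n → Reach (par ps) x 0 → reachesRoot n ps x ≡ true
reach⇐ n ps v x x≤ r =
  let (k , k≤ , e) = short-path (par ps) (suc n) (shape-par n ps v) x x≤ r
  in ∈-any (λ k → iter ps k x ≡ᵇ 0) (upTo (n + 3)) (∈-upTo⁺ (≤-trans (s≤s k≤) (n+2≤n+3 n)))
       (→≡ᵇ (trans (iter≡ ps k x) e))

IsTree : ℕ → (ℕ → ℕ) → Set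
IsTree n p = ∀ x → 1 ≤ x → x ≤ suc n → Reach p x 0

isTree⇒ : ∀ n ps → isTree n ps ≡ true → IsTree n (par ps)
isTree⇒ n ps h x 1≤ x≤ = reach⇒ n ps x (all-∈ _ (from1 (suc n)) h (∈-from1⁺ 1≤ x≤))

isTree⇐ : ∀ n ps → Shape n ps → IsTree n (par ps) → isTree n ps ≡ true
isTree⇐ n ps v t = ∈-all _ (from1 (suc n)) λ m → let (a , b) = ∈-from1⁻ m in reach⇐ n ps v _ b (t _ a b)

no-fixpoint : ∀ n p → IsTree n p → ∀ x → 1 ≤ x → x ≤ suc n → p x ≢ x
no-fixpoint n p t x a b e = let (k , r) = t x a b in <-irrefl (sym (trans (sym (iter-fixed p x e k)) r)) a

non-excedance : ∀ n p x → IsTree n p → 1 ≤ x → x ≤ suc n → (x <ᵇ p x) ≡ false → p x < x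
non-excedance n p x t a b h = ≤∧≢⇒< (≮⇒≥ (λ l → false≢true (trans (sym h) (→<ᵇ l)))) (no-fixpoint n p t x a b)

two-cycle : ∀ (p : ℕ → ℕ) a b → p a ≡ b → p b ≡ a → ∀ k → iterF p k a ≡ a ⊎ iterF p k a ≡ b
two-cycle p a b e1 e2 zero = inj₁ refl
two-cycle p a b e1 e2 (suc k) with two-cycle p a b e1 e2 k
... | inj₁ x = inj₂ (trans (cong p x) e1)
... | inj₂ x = inj₁ (trans (cong p x) e2)

desc⇒ : ∀ n ps d i → isDesc n ps d i ≡ true → Reach (par ps) (par ps d) i
desc⇒ n ps d i h = let (k , _ , e) = any-∈ _ (upTo (n + 3)) h in
  k , trans (sym (iter-suc (par ps) k d)) (trans (sym (iter≡ ps (suc k) d)) (≡ᵇ→ e))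

desc⇐ : ∀ n ps → Shape n ps → ∀ d i → Reach (par ps) (par ps d) i → isDesc n ps d i ≡ true
desc⇐ n ps v d i r =
  let (k , k≤ , e) = short-path (par ps) (suc n) (shape-par n ps v) (par ps d) (shape-par n ps v d) r
  in ∈-any (λ k → iter ps (suc k) d ≡ᵇ i) (upTo (n + 3)) (∈-upTo⁺ (≤-trans (s≤s k≤) (n+2≤n+3 n)))
       (→≡ᵇ (trans (iter≡ ps (suc k) d) (trans (iter-suc (par ps) k d) e)))

IsAlternative : ℕ → (ℕ → ℕ) → Set
IsAlternative n p = ∀ i d → 1 ≤ i → i ≤ suc n → 1 ≤ d → d ≤ suc n → Reach p (p d) i →
                    (p i < i → d < i) × (i < p i → i < d)

child-side : ∀ n ps → Shape n ps → IsAlternative n (par ps) → ∀ c x → 1 ≤ c → c ≤ suc n → par ps x ≡ c →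
             (par ps c < c → x < c) × (c < par ps c → c < x)
child-side n ps v a c x 1≤c c≤ e = let (1≤x , x≤) = child-range n ps v x c e 1≤c in a c x 1≤c c≤ 1≤x x≤ (0 , e)

isAlternative⇒ : ∀ n ps → Shape n ps → isAlternative n ps ≡ true → IsAlternative n (par ps)
isAlternative⇒ n ps v h i d 1≤i i≤ 1≤d d≤ r =
  let hi = all-∈ _ (from1 (suc n)) h (∈-from1⁺ 1≤i i≤)
      hd = all-∈ _ (from1 (suc n)) hi (∈-from1⁺ 1≤d d≤)
      (c1 , c2) = ∧-split (if-use hd (desc⇐ n ps v d i r))
  in (λ lt → <ᵇ→ (if-use c1 (→<ᵇ lt))) , (λ lt → <ᵇ→ (if-use c2 (→<ᵇ lt)))

isAlternative⇐ : ∀ n ps → IsAlternative n (par ps) → isAlternative n ps ≡ true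
isAlternative⇐ n ps a = ∈-all _ (from1 (suc n)) λ {i} mi → ∈-all _ (from1 (suc n)) λ {d} md →
  let (1≤i , i≤) = ∈-from1⁻ mi
      (1≤d , d≤) = ∈-from1⁻ md
  in if-mk λ dd → let (a1 , a2) = a i d 1≤i i≤ 1≤d d≤ (desc⇒ n ps d i dd) in
     ∧-join (if-mk (λ e → →<ᵇ (a1 (<ᵇ→ e)))) (if-mk (λ e → →<ᵇ (a2 (<ᵇ→ e))))

-- Inserting a new label ℓ: σ ℓ is the increasing injection ℕ → ℕ ∖ {ℓ},
-- and ρ ℓ is its left inverse (defined everywhere, inverse off ℓ).
σ : ℕ → ℕ → ℕ
σ ℓ x = if x <ᵇ ℓ then x else suc x

ρ : ℕ → ℕ → ℕ
ρ ℓ x = if x <ᵇ ℓ then x else pred x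

σ-lt : ∀ {ℓ x} → x < ℓ → σ ℓ x ≡ x
σ-lt {ℓ} {x} l rewrite →<ᵇ l = refl

σ-ge : ∀ {ℓ x} → ℓ ≤ x → σ ℓ x ≡ suc x
σ-ge {ℓ} {x} l rewrite <ᵇ-f {x} {ℓ} l = refl

ρ-lt : ∀ {ℓ x} → x < ℓ → ρ ℓ x ≡ x
ρ-lt {ℓ} {x} l rewrite →<ᵇ l = refl

ρ-ge : ∀ {ℓ x} → ℓ ≤ x → ρ ℓ x ≡ pred x
ρ-ge {ℓ} {x} l rewrite <ᵇ-f {x} {ℓ} l = refl

data Cmp (ℓ x : ℕ) : Set where
  lt : x < ℓ → Cmp ℓ x
  ge : ℓ ≤ x → Cmp ℓ x

cmp : ∀ ℓ x → Cmp ℓ x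
cmp ℓ x with x <? ℓ
... | yes l = lt l
... | no  n = ge (≮⇒≥ n)

ρσ : ∀ ℓ x → ρ ℓ (σ ℓ x) ≡ x
ρσ ℓ x with cmp ℓ x
... | lt l rewrite σ-lt l = ρ-lt l
... | ge g rewrite σ-ge g = ρ-ge (≤-trans g (n≤1+n x))

σρ : ∀ ℓ v → v ≢ ℓ → σ ℓ (ρ ℓ v) ≡ v
σρ ℓ v ne with cmp ℓ v
... | lt l rewrite ρ-lt l = σ-lt l
σρ ℓ zero    ne | ge g = ⊥-elim (ne (sym (n≤0⇒n≡0 g)))
σρ ℓ (suc v) ne | ge g rewrite ρ-ge g = σ-ge (≤-pred (≤∧≢⇒< g (λ e → ne (sym e))))

σ-ne : ∀ ℓ x → σ ℓ x ≢ ℓ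
σ-ne ℓ x e with cmp ℓ x
... | lt l rewrite σ-lt l = <-irrefl e l
... | ge g rewrite σ-ge g = <-irrefl (sym e) (s≤s g)

σ-mono : ∀ ℓ {a b} → a < b → σ ℓ a < σ ℓ b
σ-mono ℓ {a} {b} a<b with cmp ℓ a | cmp ℓ b
... | lt la | lt lb rewrite σ-lt la | σ-lt lb = a<b
... | lt la | ge gb rewrite σ-lt la | σ-ge gb = ≤-trans a<b (n≤1+n b)
... | ge ga | lt lb = ⊥-elim (<-asym a<b (<-≤-trans lb ga))
... | ge ga | ge gb rewrite σ-ge ga | σ-ge gb = s≤s a<b

σ-reflects : ∀ ℓ {a b} → σ ℓ a < σ ℓ b → a < b
σ-reflects ℓ {a} {b} h with <-cmp a b
... | tri< l _ _    = l
... | tri≈ _ refl _ = ⊥-elim (<-irrefl refl h)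
... | tri> _ _ g    = ⊥-elim (<-asym h (σ-mono ℓ g))

σ-inj : ∀ ℓ {a b} → σ ℓ a ≡ σ ℓ b → a ≡ b
σ-inj ℓ {a} {b} e with <-cmp a b
... | tri< l _ _ = ⊥-elim (<-irrefl e (σ-mono ℓ l))
... | tri≈ _ x _ = x
... | tri> _ _ g = ⊥-elim (<-irrefl (sym e) (σ-mono ℓ g))

σ-<ᵇ : ∀ ℓ a b → (σ ℓ a <ᵇ σ ℓ b) ≡ (a <ᵇ b)
σ-<ᵇ ℓ a b = <ᵇ-≡ (σ-reflects ℓ) (σ-mono ℓ)

σ0 : ∀ {ℓ} → 1 ≤ ℓ → σ ℓ 0 ≡ 0
σ0 l = σ-lt l

σ-≤ : ∀ ℓ x → σ ℓ x ≤ suc x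
σ-≤ ℓ x with cmp ℓ x
... | lt l rewrite σ-lt l = n≤1+n x
... | ge g rewrite σ-ge g = ≤-refl

σ-pos : ∀ ℓ x → 1 ≤ x → 1 ≤ σ ℓ x
σ-pos ℓ x h with cmp ℓ x
... | lt l rewrite σ-lt l = h
... | ge g rewrite σ-ge g = s≤s z≤n

ρ-≤ : ∀ ℓ n v → ℓ ≤ suc n → v ≤ suc (suc n) → ρ ℓ v ≤ suc n
ρ-≤ ℓ n v lℓ lv with cmp ℓ v
... | lt l rewrite ρ-lt l = ≤-trans (<⇒≤ l) lℓ
... | ge g rewrite ρ-ge g = pred-mono-≤ lv

ρ-pos : ∀ ℓ v → 1 ≤ ℓ → 1 ≤ v → v ≢ ℓ → 1 ≤ ρ ℓ v
ρ-pos ℓ v lℓ lv ne with cmp ℓ v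
... | lt l rewrite ρ-lt l = lv
... | ge g rewrite ρ-ge g = pos-pred v (≤∧≢⇒< g (λ e → ne (sym e)))
  where
  pos-pred : ∀ v → ℓ < v → 1 ≤ pred v
  pos-pred (suc v) (s≤s l) = ≤-trans lℓ l

ρ-≤-ne : ∀ ℓ m v → ℓ ≤ suc m → v ≤ suc m → v ≢ ℓ → ρ ℓ v ≤ m
ρ-≤-ne ℓ m v lℓ lv ne with cmp ℓ v
... | lt l rewrite ρ-lt l = ≤-pred (≤-trans l lℓ)
... | ge g rewrite ρ-ge g = pred-mono-≤ lv

perm-ins : ∀ m ℓ → 1 ≤ ℓ → ℓ ≤ suc m → from1 (suc m) ↭ ℓ ∷ map (σ ℓ) (from1 m)
perm-ins m ℓ l1 l2 = bag (uniq-from1 (suc m)) (notin-image (from1 m) ∷ UP.map⁺ (σ-inj ℓ) (uniq-from1 m)) to from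
  where
  notin-image : ∀ xs → All (λ y → ¬ ℓ ≡ y) (map (σ ℓ) xs)
  notin-image []       = []
  notin-image (x ∷ xs) = (λ e → σ-ne ℓ x (sym e)) ∷ notin-image xs
  to : ∀ {x} → x ∈ from1 (suc m) → x ∈ ℓ ∷ map (σ ℓ) (from1 m)
  to {x} mx with x ≟ ℓ
  ... | yes refl = here refl
  ... | no ne = let (a , b) = ∈-from1⁻ mx in
     there (subst (_∈ map (σ ℓ) (from1 m)) (σρ ℓ x ne)
       (∈-map⁺ (σ ℓ) (∈-from1⁺ (ρ-pos ℓ x l1 a ne) (ρ-≤-ne ℓ m x l2 b ne))))
  from : ∀ {x} → x ∈ ℓ ∷ map (σ ℓ) (from1 m) → x ∈ from1 (suc m)
  from (here refl) = ∈-from1⁺ l1 l2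
  from (there mx) with ∈-map⁻ (σ ℓ) mx
  ... | y , my , refl = let (a , b) = ∈-from1⁻ my in ∈-from1⁺ (σ-pos ℓ y a) (≤-trans (σ-≤ ℓ y) (s≤s b))

sum-ins : ∀ m ℓ (F : ℕ → ℕ) → 1 ≤ ℓ → ℓ ≤ suc m →
  sum (map F (from1 (suc m))) ≡ F ℓ + sum (map (λ x → F (σ ℓ x)) (from1 m))
sum-ins m ℓ F l1 l2 = trans (sum-↭ (PP.map⁺ F (perm-ins m ℓ l1 l2))) (cong (F ℓ +_) (cong sum (sym (map-∘ (from1 m)))))

sum-onehot : ∀ m t → 1 ≤ t → t ≤ m → sum (map (λ i → 𝟙 (i ≡ᵇ t)) (from1 m)) ≡ 1
sum-onehot zero    t a b = ⊥-elim (<-irrefl refl (≤-trans a b))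
sum-onehot (suc m) t a b = trans (sum-ins m t (λ i → 𝟙 (i ≡ᵇ t)) a b)
  (cong₂ _+_ (cong 𝟙 (≡ᵇ-refl t)) (others (from1 m)))
  where
  others : ∀ xs → sum (map (λ x → 𝟙 (σ t x ≡ᵇ t)) xs) ≡ 0
  others []       = refl
  others (x ∷ xs) rewrite ≡ᵇ-f (σ-ne t x) = others xs

sw : ℕ → ℕ → ℕ
sw k x = if x ≡ᵇ k then suc k else (if x ≡ᵇ suc k then k else x)

sw-k : ∀ k → sw k k ≡ suc k
sw-k k rewrite ≡ᵇ-refl k = refl

sw-sk : ∀ k → sw k (suc k) ≡ k
sw-sk k rewrite ≡ᵇ-f {suc k} {k} (λ e → <-irrefl (sym e) (n<1+n k)) | ≡ᵇ-refl k = refl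

sw-o : ∀ k x → x ≢ k → x ≢ suc k → sw k x ≡ x
sw-o k x n1 n+2≡2+n rewrite ≡ᵇ-f n1 | ≡ᵇ-f n+2≡2+n = refl

data SwCase (k x : ℕ) : Set where
  isk  : x ≡ k → SwCase k x
  issk : x ≡ suc k → SwCase k x
  oth  : x ≢ k → x ≢ suc k → SwCase k x

swCase : ∀ k x → SwCase k x
swCase k x with x ≟ k | x ≟ suc k
... | yes e | _     = isk e
... | no _  | yes e = issk e
... | no a  | no b  = oth a b

sw-sw : ∀ k x → sw k (sw k x) ≡ x
sw-sw k x with swCase k x
... | isk refl rewrite sw-k x = sw-sk x
... | issk refl rewrite sw-sk k = sw-k k
... | oth a b rewrite sw-o k x a b = sw-o k x a b

sw-inj : ∀ k {a b} → sw k a ≡ sw k b → a ≡ b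
sw-inj k {a} {b} e = trans (sym (sw-sw k a)) (trans (cong (sw k) e) (sw-sw k b))

sw0 : ∀ k → 1 ≤ k → sw k 0 ≡ 0
sw0 k l = sw-o k 0 (λ e → <-irrefl e l) (λ ())

sw-big : ∀ k x → suc k < x → sw k x ≡ x
sw-big k x l = sw-o k x (λ { refl → <-irrefl refl (<-trans (n<1+n x) l) }) (λ { refl → <-irrefl refl l })

sw-small : ∀ k x → x < k → sw k x ≡ x
sw-small k x l = sw-o k x (λ e → <-irrefl e l) (λ e → <-irrefl e (<-trans l (n<1+n k)))

sw-<ᵇ : ∀ k a b → (a ≡ k → b ≢ suc k) → (a ≡ suc k → b ≢ k) → (sw k a <ᵇ sw k b) ≡ (a <ᵇ b)
sw-<ᵇ k a b h1 h2 with swCase k a | swCase k b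
... | isk refl  | isk refl  = trans (<ᵇ-irrefl (sw k k)) (sym (<ᵇ-irrefl k))
... | isk refl  | issk refl = ⊥-elim (h1 refl refl)
... | isk refl  | oth x y rewrite sw-k a | sw-o a b x y =
  <ᵇ-≡ (<-trans (n<1+n a)) (λ l → ≤∧≢⇒< l (λ z → y (sym z)))
... | issk refl | isk refl  = ⊥-elim (h2 refl refl)
... | issk refl | issk refl = trans (<ᵇ-irrefl (sw k (suc k))) (sym (<ᵇ-irrefl (suc k)))
... | issk refl | oth x y rewrite sw-sk k | sw-o k b x y =
  <ᵇ-≡ (λ l → ≤∧≢⇒< l (λ z → y (sym z))) (<-trans (n<1+n k))
... | oth x y   | isk refl rewrite sw-k b | sw-o b a x y =
  <ᵇ-≡ (λ l → ≤∧≢⇒< (≤-pred l) x) (λ l → ≤-trans l (n≤1+n b))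
... | oth x y   | issk refl rewrite sw-sk k | sw-o k a x y =
  <ᵇ-≡ (λ l → ≤-trans l (n≤1+n k)) (λ l → ≤∧≢⇒< (≤-pred l) x)
... | oth x y   | oth x' y' rewrite sw-o k a x y | sw-o k b x' y' = refl

sw-range : ∀ k n x → 1 ≤ k → suc k ≤ n → 1 ≤ x → x ≤ n → 1 ≤ sw k x × sw k x ≤ n
sw-range k n x l1 l2 a b with swCase k x
... | isk refl  rewrite sw-k x = s≤s z≤n , l2
... | issk refl rewrite sw-sk k = l1 , ≤-trans (n≤1+n k) l2
... | oth p q   rewrite sw-o k x p q = a , b

perm-sw : ∀ n k → 1 ≤ k → suc k ≤ n → map (sw k) (from1 n) ↭ from1 n
perm-sw n k l1 l2 = bag (UP.map⁺ (sw-inj k) (uniq-from1 n)) (uniq-from1 n) to from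
  where
  to : ∀ {x} → x ∈ map (sw k) (from1 n) → x ∈ from1 n
  to mx with ∈-map⁻ (sw k) mx
  ... | y , my , refl = let (a , b) = ∈-from1⁻ my
                            (c , d) = sw-range k n y l1 l2 a b in ∈-from1⁺ c d
  from : ∀ {x} → x ∈ from1 n → x ∈ map (sw k) (from1 n)
  from {x} mx = let (a , b) = ∈-from1⁻ mx
                    (c , d) = sw-range k n x l1 l2 a b in
    subst (_∈ map (sw k) (from1 n)) (sw-sw k x) (∈-map⁺ (sw k) (∈-from1⁺ c d))

sum-sw : ∀ n k (F : ℕ → ℕ) → 1 ≤ k → suc k ≤ n →
  sum (map (λ x → F (sw k x)) (from1 n)) ≡ sum (map F (from1 n))
sum-sw n k F l1 l2 = trans (cong sum (map-∘ (from1 n))) (sum-↭ (PP.map⁺ F (perm-sw n k l1 l2)))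

-- i-th letter of a word (0-based; false beyond the end).
letter : List Bool → ℕ → Bool
letter [] _ = false
letter (b ∷ bs) zero = b
letter (b ∷ bs) (suc i) = letter bs i

eqB⇒ : ∀ w η → eqBools w η ≡ true → w ≡ η
eqB⇒ [] [] _ = refl
eqB⇒ (true ∷ w) (true ∷ η) h = cong (true ∷_) (eqB⇒ w η h)
eqB⇒ (false ∷ w) (false ∷ η) h = cong (false ∷_) (eqB⇒ w η h)
eqB⇒ (true ∷ w) (false ∷ η) ()
eqB⇒ (false ∷ w) (true ∷ η) ()
eqB⇒ [] (_ ∷ _) ()
eqB⇒ (_ ∷ _) [] ()

eqB⇐ : ∀ w → eqBools w w ≡ true
eqB⇐ [] = refl
eqB⇐ (true ∷ w) = eqB⇐ w
eqB⇐ (false ∷ w) = eqB⇐ w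

HasWord : (ℕ → Bool) → ℕ → List Bool → Set
HasWord e n η = length η ≡ n × (∀ i → i < n → e (suc i) ≡ letter η i)

private
  au⇒ : ∀ (g : ℕ → Bool) n η → applyUpTo g n ≡ η → length η ≡ n × (∀ i → i < n → g i ≡ letter η i)
  au⇒ g zero .[] refl = refl , λ i ()
  au⇒ g (suc n) .(g 0 ∷ applyUpTo (λ i → g (suc i)) n) refl =
    let (l , h) = au⇒ (λ i → g (suc i)) n _ refl in
    cong suc l , λ { zero _ → refl ; (suc i) (s≤s i<) → h i i< }
  au⇐ : ∀ (g : ℕ → Bool) n η → length η ≡ n → (∀ i → i < n → g i ≡ letter η i) → applyUpTo g n ≡ η
  au⇐ g zero [] _ _ = refl
  au⇐ g (suc n) (b ∷ η) l h = cong₂ _∷_ (h 0 (s≤s z≤n)) (au⇐ (λ i → g (suc i)) n η (suc-injective l) (λ i i< → h (suc i) (s≤s i<)))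

map-from1 : ∀ (e : ℕ → Bool) n → map e (from1 n) ≡ applyUpTo (λ i → e (suc i)) n
map-from1 e n = trans (cong (map e) (map-applyUpTo (λ x → x) suc n)) (map-applyUpTo suc e n)

word⇒ : ∀ e n η → map e (from1 n) ≡ η → HasWord e n η
word⇒ e n η h = au⇒ (λ i → e (suc i)) n η (trans (sym (map-from1 e n)) h)

word⇐ : ∀ e n η → HasWord e n η → map e (from1 n) ≡ η
word⇐ e n η (l , h) = trans (map-from1 e n) (au⇐ (λ i → e (suc i)) n η l h)

letter-lt : ∀ u v w i → i < length u → letter (u ++ v) i ≡ letter (u ++ w) i
letter-lt (x ∷ u) v w zero _ = refl
letter-lt (x ∷ u) v w (suc i) (s≤s l) = letter-lt u v w i l

letter-at : ∀ u v → letter (u ++ v) (length u) ≡ letter v 0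
letter-at [] v = refl
letter-at (x ∷ u) v = letter-at u v

letter-ge : ∀ u v w i j → length u ≤ i → letter v (i ∸ length u) ≡ letter w (j ∸ length u) → length u ≤ j → letter (u ++ v) i ≡ letter (u ++ w) j
letter-ge [] v w i j _ h _ = h
letter-ge (x ∷ u) v w (suc i) (suc j) (s≤s a) h (s≤s b) = letter-ge u v w i j a h b

sub-suc : ∀ m i → m ≤ i → suc i ∸ m ≡ suc (i ∸ m)
sub-suc m i l = +-∸-assoc 1 l

len-ins : ∀ (u : List Bool) b v n → length (u ++ b ∷ v) ≡ suc n → length (u ++ v) ≡ n
len-ins u b v n h rewrite length-++ u {b ∷ v} | length-++ u {v} | +-suc (length u) (length v) = suc-injective h

len-ins' : ∀ (u : List Bool) b v n → length (u ++ v) ≡ n → length (u ++ b ∷ v) ≡ suc n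
len-ins' u b v n h rewrite length-++ u {b ∷ v} | length-++ u {v} | +-suc (length u) (length v) = cong suc h

len-u : ∀ (u v : List Bool) → length u ≤ length (u ++ v)
len-u u v rewrite length-++ u {v} = m≤m+n _ _

word-ins⇒ : ∀ (e e' : ℕ → Bool) n u b v ℓ → ℓ ≡ suc (length u) → (∀ y → e (σ ℓ y) ≡ e' y) →
  HasWord e (suc n) (u ++ b ∷ v) → HasWord e' n (u ++ v)
word-ins⇒ e e' n u b v ℓ eℓ hσ (l , h) = len-ins u b v n l , go
  where
  go : ∀ i → i < n → e' (suc i) ≡ letter (u ++ v) i
  go i i<n with cmp ℓ (suc i)
  ... | lt sl = trans (sym (hσ (suc i))) (trans (cong e (σ-lt sl)) (trans (h i (≤-trans i<n (n≤1+n n))) (letter-lt u (b ∷ v) v i (≤-pred (subst (suc i <_) eℓ sl)))))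
  ... | ge g = trans (sym (hσ (suc i))) (trans (cong e (σ-ge g)) (trans (h (suc i) (s≤s i<n))
                 (letter-ge u (b ∷ v) v (suc i) i (≤-trans (n≤1+n _) (subst (_≤ suc i) eℓ g))
                    (cong (letter (b ∷ v)) (sub-suc (length u) i lu)) lu)))
    where lu = ≤-pred (subst (_≤ suc i) eℓ g)

word-ins⇐ : ∀ (e e' : ℕ → Bool) n u b v ℓ → ℓ ≡ suc (length u) → (∀ y → e (σ ℓ y) ≡ e' y) → e ℓ ≡ b →
  HasWord e' n (u ++ v) → HasWord e (suc n) (u ++ b ∷ v)
word-ins⇐ e e' n u b v ℓ eℓ hσ hb (l , h) = len-ins' u b v n l , go
  where
  lun : length u ≤ n
  lun = subst (length u ≤_) l (len-u u v)
  go : ∀ i → i < suc n → e (suc i) ≡ letter (u ++ b ∷ v) i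
  go i i< with <-cmp (suc i) ℓ
  ... | tri≈ _ x _ = trans (cong e x) (trans hb (sym (trans (cong (letter (u ++ b ∷ v)) (suc-injective (trans x eℓ))) (letter-at u (b ∷ v)))))
  ... | tri< sl _ _ = trans (cong e (sym (σ-lt sl))) (trans (hσ (suc i)) (trans (h i (<-≤-trans il lun)) (letter-lt u v (b ∷ v) i il)))
    where il = ≤-pred (subst (suc i <_) eℓ sl)
  go (suc j) i< | tri> _ _ g = trans (cong e (sym (σ-ge g'))) (trans (hσ (suc j)) (trans (h j (≤-pred i<))
      (letter-ge u v (b ∷ v) j (suc j) lu (cong (letter (b ∷ v)) (sym (sub-suc (length u) j lu))) (≤-trans lu (n≤1+n j)))))
    where
    g' : ℓ ≤ suc j
    g' = ≤-pred g
    lu : length u ≤ j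
    lu = ≤-pred (subst (_≤ suc j) eℓ g')
  go zero i< | tri> _ _ g with subst (_< 1) eℓ g
  ... | s≤s ()

letter-away : ∀ u (a b c d : Bool) v i → i ≢ length u → i ≢ suc (length u) → letter (u ++ a ∷ b ∷ v) i ≡ letter (u ++ c ∷ d ∷ v) i
letter-away [] a b c d v zero n1 n₂ = ⊥-elim (n1 refl)
letter-away [] a b c d v (suc zero) n1 n₂ = ⊥-elim (n₂ refl)
letter-away [] a b c d v (suc (suc i)) n1 n₂ = refl
letter-away (x ∷ u) a b c d v zero n1 n₂ = refl
letter-away (x ∷ u) a b c d v (suc i) n1 n₂ = letter-away u a b c d v i (λ e → n1 (cong suc e)) (λ e → n₂ (cong suc e))

letter-at1 : ∀ u (a b : Bool) v → letter (u ++ a ∷ b ∷ v) (suc (length u)) ≡ b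
letter-at1 [] a b v = refl
letter-at1 (x ∷ u) a b v = letter-at1 u a b v

len-sw : ∀ u (a b : Bool) v → length (u ++ a ∷ b ∷ v) ≡ length (u ++ b ∷ a ∷ v)
len-sw u a b v rewrite length-++ u {a ∷ b ∷ v} | length-++ u {b ∷ a ∷ v} = refl

word-sw : ∀ (e e' : ℕ → Bool) n u a b v → suc (suc (length u)) ≤ n → (∀ y → e' (sw (suc (length u)) y) ≡ e y) →
  HasWord e n (u ++ a ∷ b ∷ v) → HasWord e' n (u ++ b ∷ a ∷ v)
word-sw e e' n u a b v k+1≤n h (l , w) = trans (sym (len-sw u a b v)) l , go
  where
  k = suc (length u)
  η = u ++ a ∷ b ∷ v
  η' = u ++ b ∷ a ∷ v
  e's : ∀ y → e' y ≡ e (sw k y)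
  e's y = trans (cong e' (sym (sw-sw k y))) (h (sw k y))
  go : ∀ i → i < n → e' (suc i) ≡ letter η' i
  go i i< with swCase k (suc i)
  ... | isk x = trans (e's (suc i)) (trans (cong e (trans (cong (sw k) x) (sw-k k))) (trans (w k k+1≤n)
        (trans (letter-at1 u a b v) (sym (trans (cong (letter η') (suc-injective x)) (letter-at u (b ∷ a ∷ v)))))))
  ... | issk x = trans (e's (suc i)) (trans (cong e (trans (cong (sw k) x) (sw-sk k))) (trans (w (length u) (≤-trans (n≤1+n _) k+1≤n))
        (trans (letter-at u (a ∷ b ∷ v)) (sym (trans (cong (letter η') (suc-injective x)) (letter-at1 u b a v))))))
  ... | oth x y = trans (e's (suc i)) (trans (cong e (sw-o k (suc i) x y)) (trans (w i i<)
        (letter-away u a b b a v i (λ z → x (cong suc z)) (λ z → y (cong suc z)))))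

yyPair : (ℕ → ℕ) → ℕ → ℕ → Bool
yyPair p i j = (p j <ᵇ i) ∧ (i <ᵇ j) ∧ (j <ᵇ p i)

yySum : ℕ → (ℕ → ℕ) → ℕ
yySum n p = sum (map (λ j → sum (map (λ i → 𝟙 (yyPair p i j)) (from1 n))) (from1 n))

yy-gen : ∀ (P : List ℕ → Bool) (xs : List ℕ) → length (filterᵇ P (concatMap (λ j → map (λ i → i ∷ j ∷ []) xs) xs)) ≡ sum (map (λ j → sum (map (λ i → 𝟙 (P (i ∷ j ∷ []))) xs)) xs)
yy-gen P xs = trans (length-filter P (concatMap (λ j → map (λ i → i ∷ j ∷ []) xs) xs)) (trans (sum-concatMap (λ j → map (λ i → i ∷ j ∷ []) xs) (λ x → 𝟙 (P x)) xs)
  (sum-map-cong _ _ xs (λ {j} _ → cong sum (sym (map-∘ xs)))))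

yy≡ : ∀ n ps → yy n ps ≡ yySum n (par ps)
yy≡ n ps = yy-gen _ (from1 n)

chSum : ℕ → (ℕ → ℕ) → ℕ → ℕ
chSum n p v = sum (map (λ i → 𝟙 (p i ≡ᵇ v)) (from1 (suc n)))

ch≡ : ∀ n ps v → children n ps v ≡ chSum n (par ps) v
ch≡ n ps v = length-filter (λ i → par ps i ≡ᵇ v) (from1 (suc n))

-- We generalise the three
-- statistics tests to arbitrary predicates C0, C1, Y and allow an extra
-- Boolean filter E, so that a bracket can be split into cases (E) and the
-- shift a ↦ a·x of a monomial becomes a change of predicate.

Ok : ℕ → List Bool → (ℕ → Bool) → (ℕ → Bool) → (ℕ → Bool) → List ℕ → Bool
Ok n η C0 C1 Y ps = isTree n ps ∧ isAlternative n ps ∧ eqBools (excWord n ps) η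
          ∧ C0 (c0 n ps) ∧ C1 (c1 n ps) ∧ Y (yy n ps)

count : ℕ → List Bool → (ℕ → Bool) → (ℕ → Bool) → (ℕ → Bool) → (List ℕ → Bool) → ℕ
count n η C0 C1 Y E = length (filterᵇ (λ ps → Ok n η C0 C1 Y ps ∧ E ps) (vecs (suc n) (n + 2)))

bracket≡ : ∀ η n → length η ≡ n → ∀ i j k → bracket η i j k ≡ length (filterᵇ (Ok n η (_≡ᵇ i) (_≡ᵇ j) (_≡ᵇ k)) (vecs (suc n) (n + 2)))
bracket≡ η .(length η) refl i j k = refl

record Counted (n : ℕ) (η : List Bool) (C0 C1 Y : ℕ → Bool) (ps : List ℕ) : Set where
  field
    shape : Shape n ps
    tree : IsTree n (par ps)
    alt : IsAlternative n (par ps)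
    word : HasWord (λ x → x <ᵇ par ps x) n η
    c₀-ok : C0 (chSum n (par ps) 0) ≡ true
    c₁-ok : C1 (chSum n (par ps) (suc n)) ≡ true
    yy-ok : Y (yySum n (par ps)) ≡ true

n+2≡2+n : ∀ n → n + 2 ≡ suc (suc n)
n+2≡2+n n = +-comm n 2

ok⇒ : ∀ n η C0 C1 Y ps → ps ∈ vecs (suc n) (n + 2) → Ok n η C0 C1 Y ps ≡ true → Counted n η C0 C1 Y ps
ok⇒ n η C0 C1 Y ps m h =
  let (l , b) = ∈-vecs⁻ (suc n) (n + 2) ps m
      v : Shape n ps
      v = l , subst (λ z → Bounded z ps) (n+2≡2+n n) b
      (a1 , r1) = ∧-split h
      (a2 , r2) = ∧-split r1
      (a3 , r3) = ∧-split r2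
      (a4 , r4) = ∧-split r3
      (a5 , a6) = ∧-split r4
  in record { shape = v ; tree = isTree⇒ n ps a1 ; alt = isAlternative⇒ n ps v a2
            ; word = word⇒ (λ x → x <ᵇ par ps x) n η (eqB⇒ _ η a3)
            ; c₀-ok = subst (λ z → C0 z ≡ true) (ch≡ n ps 0) a4
            ; c₁-ok = subst (λ z → C1 z ≡ true) (ch≡ n ps (suc n)) a5
            ; yy-ok = subst (λ z → Y z ≡ true) (yy≡ n ps) a6 }

ok⇐ : ∀ n η C0 C1 Y ps → Counted n η C0 C1 Y ps → ps ∈ vecs (suc n) (n + 2) × Ok n η C0 C1 Y ps ≡ true
ok⇐ n η C0 C1 Y ps g = ∈-vecs⁺ (suc n) (n + 2) ps (proj₁ shape) (subst (λ z → Bounded z ps) (sym (n+2≡2+n n)) (proj₂ shape)) ,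
  ∧-join (isTree⇐ n ps shape tree) (∧-join (isAlternative⇐ n ps alt)
    (∧-join (subst (λ z → eqBools z η ≡ true) (sym (word⇐ (λ x → x <ᵇ par ps x) n η word)) (eqB⇐ η))
      (∧-join (subst (λ z → C0 z ≡ true) (sym (ch≡ n ps 0)) c₀-ok)
        (∧-join (subst (λ z → C1 z ≡ true) (sym (ch≡ n ps (suc n))) c₁-ok)
          (subst (λ z → Y z ≡ true) (sym (yy≡ n ps)) yy-ok)))))
  where open Counted g

count-good : ∀ n η C0 C1 Y (E : List ℕ → Bool) n' η' C0' C1' Y' (E' : List ℕ → Bool) (f g : List ℕ → List ℕ) →
  (∀ ps → Counted n η C0 C1 Y ps → E ps ≡ true → Counted n' η' C0' C1' Y' (f ps) × E' (f ps) ≡ true × g (f ps) ≡ ps) →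
  (∀ ps → Counted n' η' C0' C1' Y' ps → E' ps ≡ true → Counted n η C0 C1 Y (g ps) × E (g ps) ≡ true × f (g ps) ≡ ps) →
  count n η C0 C1 Y E ≡ count n' η' C0' C1' Y' E'
count-good n η C0 C1 Y E n' η' C0' C1' Y' E' f g to01 from01 =
  count-bij _ _ f g (uniq-vecs (suc n) (n + 2)) (uniq-vecs (suc n') (n' + 2))
    (λ ps m h → let (h1 , h2) = ∧-split h
                    (gd , e , r) = to01 ps (ok⇒ n η C0 C1 Y ps m h1) h2
                    (m' , o') = ok⇐ n' η' C0' C1' Y' (f ps) gd in
                m' , ∧-join o' e , r)
    (λ ps m h → let (h1 , h2) = ∧-split h
                    (gd , e , r) = from01 ps (ok⇒ n' η' C0' C1' Y' ps m h1) h2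
                    (m' , o') = ok⇐ n η C0 C1 Y (g ps) gd in
                m' , ∧-join o' e , r)

bracket-count : ∀ η n → length η ≡ n → ∀ i j k →
  bracket η i j k ≡ count n η (_≡ᵇ i) (_≡ᵇ j) (_≡ᵇ k) (λ _ → true)
bracket-count η n e i j k = trans (bracket≡ η n e i j k)
  (count-cong _ _ (vecs (suc n) (n + 2)) (λ {x} _ → sym (∧-identityʳ (Ok n η (_≡ᵇ i) (_≡ᵇ j) (_≡ᵇ k) x))))

census-empty : ∀ n η C0 C1 Y → (∀ ps → Counted n η C0 C1 Y ps → ⊥) → count n η C0 C1 Y (λ _ → true) ≡ 0
census-empty n η C0 C1 Y none = count-zero-∈ _ (vecs (suc n) (n + 2)) absent
  where
  absent : ∀ {ps} → ps ∈ vecs (suc n) (n + 2) → (Ok n η C0 C1 Y ps ∧ true) ≡ false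
  absent {ps} m with Ok n η C0 C1 Y ps in e
  ... | true  = ⊥-elim (none ps (ok⇒ n η C0 C1 Y ps m e))
  ... | false = refl

wordAt : ∀ {n η C0 C1 Y ps} → Counted n η C0 C1 Y ps → ∀ i → i < n → (suc i <ᵇ par ps (suc i)) ≡ letter η i
wordAt g i l = proj₂ (Counted.word g) i l

-- The parent q of the new leaf is a neighbour
-- of ℓ (ℓ - 1 ≤ q ≤ ℓ + 1, q ≠ ℓ), so no old vertex lies strictly between
-- them; this is what makes the new leaf harmless for the alternative
-- condition (up to the side condition LeafC) and for yy.

module LeafInsertion (n ℓ q : ℕ) (1≤ℓ : 1 ≤ ℓ) (ℓ≤ : ℓ ≤ suc n) (q≤ : q ≤ suc (suc n))
           (ℓ≤q+1 : ℓ ≤ suc q) (q≤ℓ+1 : q ≤ suc ℓ) (q≢ℓ : q ≢ ℓ) where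

  insF : List ℕ → ℕ → ℕ
  insF ps' v = if v ≡ᵇ ℓ then q else σ ℓ (par ps' (ρ ℓ v))

  ins : List ℕ → List ℕ
  ins ps' = tab (suc (suc n)) (insF ps')

  del : List ℕ → List ℕ
  del ps = tab (suc n) (λ v → ρ ℓ (par ps (σ ℓ v)))

  ℓ≤n+2 : ℓ ≤ suc (suc n)
  ℓ≤n+2 = ≤-trans ℓ≤ (n≤1+n _)

  σ-range : ∀ x → 1 ≤ x → x ≤ suc n → 1 ≤ σ ℓ x × σ ℓ x ≤ suc (suc n)
  σ-range x a b = σ-pos ℓ x a , ≤-trans (σ-≤ ℓ x) (s≤s b)

  ρ-range : ∀ x → 1 ≤ x → x ≤ suc (suc n) → x ≢ ℓ → 1 ≤ ρ ℓ x × ρ ℓ x ≤ suc n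
  ρ-range x a b ne = ρ-pos ℓ x 1≤ℓ a ne , ρ-≤-ne ℓ (suc n) x ℓ≤n+2 b ne

  par-ins-ℓ : ∀ ps' → par (ins ps') ℓ ≡ q
  par-ins-ℓ ps' rewrite par-tab (suc (suc n)) (insF ps') ℓ 1≤ℓ ℓ≤n+2 | ≡ᵇ-refl ℓ = refl

  par-ins-σ : ∀ ps' → Shape n ps' → ∀ x → par (ins ps') (σ ℓ x) ≡ σ ℓ (par ps' x)
  par-ins-σ ps' v zero = trans (cong (par (ins ps')) (σ0 1≤ℓ)) (sym (σ0 1≤ℓ))
  par-ins-σ ps' v (suc x) with suc x ≤? suc n
  ... | yes le = let (a , b) = σ-range (suc x) (s≤s z≤n) le in
    trans (par-tab (suc (suc n)) (insF ps') (σ ℓ (suc x)) a b)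
     (trans (cong (λ z → if z then q else σ ℓ (par ps' (ρ ℓ (σ ℓ (suc x))))) (≡ᵇ-f (σ-ne ℓ (suc x))))
      (cong (λ z → σ ℓ (par ps' z)) (ρσ ℓ (suc x))))
  ... | no nle = let g = ≰⇒> nle in
    trans (cong (par (ins ps')) (σ-ge (≤-trans ℓ≤ (<⇒≤ g))))
     (trans (par-out (ins ps') (suc (suc x)) (subst (_< suc (suc x)) (sym (length-tab (suc (suc n)) (insF ps'))) (s≤s g)))
      (trans (sym (σ0 1≤ℓ)) (cong (σ ℓ) (sym (par-out ps' (suc x) (subst (_< suc x) (sym (proj₁ v)) g))))))

  shape-ins : ∀ ps' → Shape n ps' → Shape (suc n) (ins ps')
  shape-ins ps' v = length-tab (suc (suc n)) (insF ps') , bounded-tab (suc (suc n)) _ (insF ps') bd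
    where
    bd : ∀ i → 1 ≤ i → i ≤ suc (suc n) → insF ps' i < suc (suc (suc n))
    bd i _ _ with i ≡ᵇ ℓ
    ... | true  = s≤s q≤
    ... | false = s≤s (≤-trans (σ-≤ ℓ (par ps' (ρ ℓ i))) (s≤s (shape-par n ps' v (ρ ℓ i))))

  shape-del : ∀ ps → Shape (suc n) ps → Shape n (del ps)
  shape-del ps v = length-tab (suc n) F , bounded-tab (suc n) _ F (λ i _ _ → s≤s (ρ-≤ ℓ n _ ℓ≤ (shape-par (suc n) ps v (σ ℓ i))))
    where F = λ v → ρ ℓ (par ps (σ ℓ v))

  del-ins : ∀ ps' → Shape n ps' → del (ins ps') ≡ ps'
  del-ins ps' v = trans (tab-cong (suc n) (λ v → ρ ℓ (par (ins ps') (σ ℓ v))) (par ps') (λ i _ _ → trans (cong (ρ ℓ) (par-ins-σ ps' v i)) (ρσ ℓ _)))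
    (trans (cong (λ m → tab m (par ps')) (sym (proj₁ v))) (sym (tab-par ps')))

  ins-del : ∀ ps → Shape (suc n) ps → par ps ℓ ≡ q → (∀ x → par ps x ≢ ℓ) → ins (del ps) ≡ ps
  ins-del ps v pq leaf = trans (tab-cong (suc (suc n)) (insF (del ps)) (par ps) pt) (trans (cong (λ m → tab m (par ps)) (sym (proj₁ v))) (sym (tab-par ps)))
    where
    pt : ∀ i → 1 ≤ i → i ≤ suc (suc n) → insF (del ps) i ≡ par ps i
    pt i a b with i ≟ ℓ
    ... | yes refl rewrite ≡ᵇ-refl i = sym pq
    ... | no ne rewrite ≡ᵇ-f ne | par-tab (suc n) (λ v → ρ ℓ (par ps (σ ℓ v))) (ρ ℓ i) (proj₁ (ρ-range i a b ne)) (proj₂ (ρ-range i a b ne))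
       | σρ ℓ i ne = σρ ℓ (par ps i) (leaf i)

  q' : ℕ
  q' = ρ ℓ q

  σq' : σ ℓ q' ≡ q
  σq' = σρ ℓ q q≢ℓ

  q'≤ : q' ≤ suc n
  q'≤ = ρ-≤ ℓ n q ℓ≤ q≤

  -- Since q is adjacent to ℓ, comparing an old vertex i' with q' tells on
  -- which side of ℓ its new name lies.
  side-of-ℓ : ∀ i' → (q' < i' → ℓ < σ ℓ i') × (i' < q' → σ ℓ i' < ℓ)
  side-of-ℓ i' with <-cmp q ℓ
  ... | tri≈ _ e _ = ⊥-elim (q≢ℓ e)
  ... | tri< ql _ _ = (λ h → let li = subst (_≤ i') (sym ℓ≡q+1) (subst (_< i') (ρ-lt ql) h) in subst (ℓ <_) (sym (σ-ge li)) (s≤s li))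
                    , (λ h → let il = <-trans (subst (i' <_) (ρ-lt ql) h) ql in subst (_< ℓ) (sym (σ-lt il)) il)
    where
    ℓ≡q+1 : ℓ ≡ suc q
    ℓ≡q+1 = ≤-antisym ℓ≤q+1 ql
  ... | tri> _ _ lq = (λ h → let li = subst (_< i') q'≡ℓ h in subst (ℓ <_) (sym (σ-ge (<⇒≤ li))) (≤-trans li (n≤1+n _)))
                    , (λ h → let il = subst (i' <_) q'≡ℓ h in subst (_< ℓ) (sym (σ-lt il)) il)
    where
    q'≡ℓ : q' ≡ ℓ
    q'≡ℓ = trans (ρ-ge (<⇒≤ lq)) (cong pred (≤-antisym q≤ℓ+1 lq))

  module Transport (ps' : List ℕ) (v : Shape n ps') where
    p  = par (ins ps')
    p' = par ps'

    pℓ : p ℓ ≡ q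
    pℓ = par-ins-ℓ ps'

    pσ : ∀ x → p (σ ℓ x) ≡ σ ℓ (p' x)
    pσ = par-ins-σ ps' v

    iter-σ : ∀ k x → iterF p k (σ ℓ x) ≡ σ ℓ (iterF p' k x)
    iter-σ zero    x = refl
    iter-σ (suc k) x = trans (cong p (iter-σ k x)) (pσ _)

    reach⁺ : ∀ {x y} → Reach p' x y → Reach p (σ ℓ x) (σ ℓ y)
    reach⁺ (k , e) = k , trans (iter-σ k _) (cong (σ ℓ) e)

    reach⁻ : ∀ {x y} → Reach p (σ ℓ x) (σ ℓ y) → Reach p' x y
    reach⁻ (k , e) = k , σ-inj ℓ (trans (sym (iter-σ k _)) e)

    no-reach-ℓ : ∀ {x} → Reach p (σ ℓ x) ℓ → ⊥
    no-reach-ℓ (k , e) = σ-ne ℓ _ (trans (sym (iter-σ k _)) e)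

    reach0 : ∀ {x} → Reach p' x 0 → Reach p (σ ℓ x) 0
    reach0 r = subst (Reach p _) (σ0 1≤ℓ) (reach⁺ r)

    tree⇒-del : IsTree (suc n) p → IsTree n p'
    tree⇒-del t x a b = let (c , d) = σ-range x a b in reach⁻ (subst (Reach p (σ ℓ x)) (sym (σ0 1≤ℓ)) (t (σ ℓ x) c d))

    tree⇐-ins : IsTree n p' → IsTree (suc n) p
    tree⇐-ins t x a b with x ≟ ℓ
    ... | yes refl = let (k , e) = q-reaches-root in suc k , trans (iter-suc p k x) (trans (cong (iterF p k) pℓ) e)
      where
      q-reaches-root : Reach p q 0
      q-reaches-root with q' ≟ 0
      ... | yes z = subst (λ w → Reach p w 0) σq' (0 , trans (cong (σ ℓ) z) (σ0 1≤ℓ))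
      ... | no nz = subst (λ w → Reach p w 0) σq' (reach0 (t q' (n≢0⇒n>0 nz) q'≤))
    ... | no ne = let (a' , b') = ρ-range x a b ne in subst (λ w → Reach p w 0) (σρ ℓ x ne) (reach0 (t (ρ ℓ x) a' b'))

    alt⇒-del : IsAlternative (suc n) p → IsAlternative n p'
    alt⇒-del a i d i1 i2 d1 d2 r =
      let (si1 , si2) = σ-range i i1 i2
          (sd1 , sd2) = σ-range d d1 d2
          r' = subst (λ w → Reach p w (σ ℓ i)) (sym (pσ d)) (reach⁺ r)
          (c1 , c2) = a (σ ℓ i) (σ ℓ d) si1 si2 sd1 sd2 r'
      in (λ lt → σ-reflects ℓ (c1 (subst (_< σ ℓ i) (sym (pσ i)) (σ-mono ℓ lt))))
       , (λ lt → σ-reflects ℓ (c2 (subst (σ ℓ i <_) (sym (pσ i)) (σ-mono ℓ lt))))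

    LeafC : Set
    LeafC = 1 ≤ q' → (p' q' < q' → ℓ < σ ℓ q') × (q' < p' q' → σ ℓ q' < ℓ)

    leaf-side : IsAlternative n p' → LeafC → ∀ {i'} → 1 ≤ i' → i' ≤ suc n → Reach p' q' i' →
                (p' i' < i' → ℓ < σ ℓ i') × (i' < p' i' → σ ℓ i' < ℓ)
    leaf-side a lc i'1 i'2 (zero , refl) = lc i'1
    leaf-side a lc {i'} i'1 i'2 (suc k , e) with q' ≟ 0
    ... | yes z = ⊥-elim (<-irrefl (sym (trans (sym e) (trans (cong (iterF p' (suc k)) z) (iter-fixed p' 0 refl (suc k))))) i'1)
    ... | no nz = let (c1 , c2) = a i' q' i'1 i'2 (n≢0⇒n>0 nz) q'≤ (k , trans (sym (iter-suc p' k q')) e)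
                      (e1 , e2) = side-of-ℓ i' in
                  (λ h → e1 (c1 h)) , (λ h → e2 (c2 h))

    old-side : ∀ {i' d} → (p' i' < i' → d < σ ℓ i') × (i' < p' i' → σ ℓ i' < d) →
               (p (σ ℓ i') < σ ℓ i' → d < σ ℓ i') × (σ ℓ i' < p (σ ℓ i') → σ ℓ i' < d)
    old-side {i'} (c1 , c2) = (λ h → c1 (σ-reflects ℓ (subst (_< σ ℓ i') (pσ i') h)))
                            , (λ h → c2 (σ-reflects ℓ (subst (σ ℓ i' <_) (pσ i') h)))

    -- The new leaf ℓ has no descendants, and every old vertex keeps its
    -- order relations, so the only new instance is the leaf itself.
    alt⇐-ins : IsAlternative n p' → LeafC → IsAlternative (suc n) p
    alt⇐-ins a lc i d i1 i2 d1 d2 r with i ≟ ℓ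
    ... | yes refl = ⊥-elim (no-reach-ℓ (subst (λ w → Reach p w i) pd r))
      where
      pd : p d ≡ σ i (if d ≡ᵇ i then q' else p' (ρ i d))
      pd with d ≟ i
      ... | yes refl rewrite ≡ᵇ-refl d = trans pℓ (sym σq')
      ... | no ne rewrite ≡ᵇ-f ne = trans (cong p (sym (σρ i d ne))) (pσ (ρ i d))
    ... | no ine = subst (λ w → (p w < w → d < w) × (w < p w → w < d)) (σρ ℓ i ine) at-old-vertex
      where
      i' = ρ ℓ i
      r1 : Reach p (p d) (σ ℓ i')
      r1 = subst (Reach p (p d)) (sym (σρ ℓ i ine)) r
      at-old-vertex : (p (σ ℓ i') < σ ℓ i' → d < σ ℓ i') × (σ ℓ i' < p (σ ℓ i') → σ ℓ i' < d)
      at-old-vertex with d ≟ ℓ | ρ-range i i1 i2 ine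
      ... | yes refl | (i'1 , i'2) = old-side (leaf-side a lc i'1 i'2
            (reach⁻ (subst (λ w → Reach p w (σ ℓ i')) (trans pℓ (sym σq')) r1)))
      ... | no dne   | (i'1 , i'2) =
        let (d'1 , d'2) = ρ-range d d1 d2 dne
            r2 = reach⁻ (subst (λ w → Reach p w (σ ℓ i')) (trans (cong p (sym (σρ ℓ d dne))) (pσ (ρ ℓ d))) r1)
            (c1 , c2) = a i' (ρ ℓ d) i'1 i'2 d'1 d'2 r2
        in old-side ((λ h → subst (_< σ ℓ i') (σρ ℓ d dne) (σ-mono ℓ (c1 h)))
                   , (λ h → subst (σ ℓ i' <_) (σρ ℓ d dne) (σ-mono ℓ (c2 h))))

    children-ins : ∀ w → chSum (suc n) p (σ ℓ w) ≡ 𝟙 (q ≡ᵇ σ ℓ w) + chSum n p' w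
    children-ins w = trans (sum-ins (suc n) ℓ (λ i → 𝟙 (p i ≡ᵇ σ ℓ w)) 1≤ℓ ℓ≤n+2)
      (cong₂ _+_ (cong (λ z → 𝟙 (z ≡ᵇ σ ℓ w)) pℓ)
        (sum-map-cong _ _ (from1 (suc n)) (λ {x} _ → cong 𝟙 (trans (cong (λ z → z ≡ᵇ σ ℓ w) (pσ x)) (≡ᵇ-inj (σ ℓ) (σ-inj ℓ) (p' x) w)))))

    -- The new leaf is in no yy-pair: as j = ℓ no i lies in (q, ℓ), and as
    -- i = ℓ no j lies in (ℓ, q); old pairs are unchanged.
    yy-ins : yySum (suc n) p ≡ yySum n p'
    yy-ins = trans (sum-ins n ℓ G 1≤ℓ ℓ≤) (trans (cong (_+ sum (map (λ z → G (σ ℓ z)) (from1 n))) Gℓ) (sum-map-cong (λ z → G (σ ℓ z)) _ (from1 n) (λ {j} _ → Gσ j)))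
      where
      G : ℕ → ℕ
      G j = sum (map (λ i → 𝟙 (yyPair p i j)) (from1 (suc n)))
      Gℓ : G ℓ ≡ 0
      Gℓ = trans (sum-map-cong _ (λ _ → 0) (from1 (suc n)) (λ {i} _ → cong 𝟙 (no-pair-below i))) (sum-zeros (from1 (suc n)))
        where
        no-pair-below : ∀ i → yyPair p i ℓ ≡ false
        no-pair-below i rewrite pℓ with <ᵇ-dec q i
        ... | inj₂ (e , _)  = ∧-false₁ (i <ᵇ ℓ) (ℓ <ᵇ p i) e
        ... | inj₁ (_ , qi) = ∧-false₂ (q <ᵇ i) (ℓ <ᵇ p i) (<ᵇ-f (≤-trans ℓ≤q+1 qi))
      Gσ : ∀ j → G (σ ℓ j) ≡ sum (map (λ i → 𝟙 (yyPair p' i j)) (from1 n))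
      Gσ j = trans (sum-ins n ℓ (λ i → 𝟙 (yyPair p i (σ ℓ j))) 1≤ℓ ℓ≤)
        (cong₂ _+_ (cong 𝟙 no-pair-above) (sum-map-cong (λ i → 𝟙 (yyPair p (σ ℓ i) (σ ℓ j))) (λ i → 𝟙 (yyPair p' i j)) (from1 n) (λ {i} _ → cong 𝟙 (old-pair i))))
        where
        no-pair-above : yyPair p ℓ (σ ℓ j) ≡ false
        no-pair-above rewrite pℓ with <ᵇ-dec ℓ (σ ℓ j)
        ... | inj₂ (e , _)  = ∧-false₂ (p (σ ℓ j) <ᵇ ℓ) (σ ℓ j <ᵇ q) e
        ... | inj₁ (e , lj) rewrite e | <ᵇ-f {σ ℓ j} {q} (≤-trans q≤ℓ+1 lj) = ∧-false₃ (p (σ ℓ j) <ᵇ ℓ) true refl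
        old-pair : ∀ i → yyPair p (σ ℓ i) (σ ℓ j) ≡ yyPair p' i j
        old-pair i rewrite pσ i | pσ j | σ-<ᵇ ℓ (p' j) i | σ-<ᵇ ℓ i j | σ-<ᵇ ℓ j (p' i) = refl

  -- Positions: ℓ is the letter after u, whose
  -- value b records whether ℓ < q; the predicates C0', C1' absorb the
  -- extra child that q gains when it is 0 or n+2.
  module Count (u : List Bool) (b : Bool) (w : List Bool) (eℓ : ℓ ≡ suc (length u)) (eb : (ℓ <ᵇ q) ≡ b)
           (C0 C1 C0' C1' Y : ℕ → Bool)
           (h0 : ∀ x → C0 (𝟙 (q ≡ᵇ 0) + x) ≡ C0' x) (h1 : ∀ x → C1 (𝟙 (q ≡ᵇ suc (suc n)) + x) ≡ C1' x) where

    σ-root : σ ℓ 0 ≡ 0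
    σ-root = σ0 1≤ℓ
    σ-top : σ ℓ (suc n) ≡ suc (suc n)
    σ-top = σ-ge ℓ≤

    module _ (ps' : List ℕ) (v : Shape n ps') where
      open Transport ps' v
      hσ : ∀ y → (σ ℓ y <ᵇ p (σ ℓ y)) ≡ (y <ᵇ p' y)
      hσ y = trans (cong (σ ℓ y <ᵇ_) (pσ y)) (σ-<ᵇ ℓ y (p' y))
      ch0 : chSum (suc n) p 0 ≡ 𝟙 (q ≡ᵇ 0) + chSum n p' 0
      ch0 = trans (cong (chSum (suc n) p) (sym σ-root)) (trans (children-ins 0) (cong (λ z → 𝟙 (q ≡ᵇ z) + chSum n p' 0) σ-root))
      ch1 : chSum (suc n) p (suc (suc n)) ≡ 𝟙 (q ≡ᵇ suc (suc n)) + chSum n p' (suc n)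
      ch1 = trans (cong (chSum (suc n) p) (sym σ-top)) (trans (children-ins (suc n)) (cong (λ z → 𝟙 (q ≡ᵇ z) + chSum n p' (suc n)) σ-top))
      eb' : (ℓ <ᵇ p ℓ) ≡ b
      eb' = trans (cong (ℓ <ᵇ_) pℓ) eb

      counted-ins : Counted n (u ++ w) C0' C1' Y ps' → LeafC → Counted (suc n) (u ++ b ∷ w) C0 C1 Y (ins ps')
      counted-ins g lc = record
        { shape = shape-ins ps' v
        ; tree = tree⇐-ins tree
        ; alt = alt⇐-ins alt lc
        ; word = word-ins⇐ (λ x → x <ᵇ p x) (λ x → x <ᵇ p' x) n u b w ℓ eℓ hσ eb' word
        ; c₀-ok = trans (cong C0 ch0) (trans (h0 _) c₀-ok)
        ; c₁-ok = trans (cong C1 ch1) (trans (h1 _) c₁-ok)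
        ; yy-ok = trans (cong Y yy-ins) yy-ok }
        where open Counted g

      counted-del : Counted (suc n) (u ++ b ∷ w) C0 C1 Y (ins ps') → Counted n (u ++ w) C0' C1' Y ps'
      counted-del g = record
        { shape = v
        ; tree = tree⇒-del tree
        ; alt = alt⇒-del alt
        ; word = word-ins⇒ (λ x → x <ᵇ p x) (λ x → x <ᵇ p' x) n u b w ℓ eℓ hσ word
        ; c₀-ok = trans (sym (h0 _)) (trans (cong C0 (sym ch0)) c₀-ok)
        ; c₁-ok = trans (sym (h1 _)) (trans (cong C1 (sym ch1)) c₁-ok)
        ; yy-ok = trans (cong Y (sym yy-ins)) yy-ok }
        where open Counted g

    leaf-count : ∀ (E : List ℕ → Bool) →
      (∀ ps → Counted (suc n) (u ++ b ∷ w) C0 C1 Y ps → E ps ≡ true → par ps ℓ ≡ q × (∀ x → par ps x ≢ ℓ)) →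
      (∀ ps' → (g : Counted n (u ++ w) C0' C1' Y ps') → Transport.LeafC ps' (Counted.shape g)) →
      (∀ ps' → Counted n (u ++ w) C0' C1' Y ps' → E (ins ps') ≡ true) →
      count (suc n) (u ++ b ∷ w) C0 C1 Y E ≡ count n (u ++ w) C0' C1' Y (λ _ → true)
    leaf-count E leaf-in-tree side-ok inserted-in-class = count-good (suc n) (u ++ b ∷ w) C0 C1 Y E n (u ++ w) C0' C1' Y (λ _ → true) del ins
      (λ ps g e → let (pq , childless) = leaf-in-tree ps g e
                      v = Counted.shape g
                      id = ins-del ps v pq childless
                      v' = shape-del ps v
                      g' = subst (Counted (suc n) (u ++ b ∷ w) C0 C1 Y) (sym id) g
                  in counted-del (del ps) v' g' , refl , id)
      (λ ps' g' _ → let v' = Counted.shape g' in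
                    counted-ins ps' v' g' (side-ok ps' g') , inserted-in-class ps' g' , del-ins ps' v')

-- Key combinatorial fact (CrossingPairs.P.split): if k is an excedance and
-- k+1 is not, and neither is the parent of the other, then relabelling by
-- sw k destroys exactly one yy-pair, namely (k, k+1), and preserves all
-- others.

module CrossingPairs (k : ℕ) where

  Apart : ℕ → ℕ → Set
  Apart a b = (a ≡ k → b ≢ suc k) × (a ≡ suc k → b ≢ k)

  Adjacent : ℕ → ℕ → Set
  Adjacent a b = (a ≡ k × b ≡ suc k) ⊎ (a ≡ suc k × b ≡ k)

  adjacent? : ∀ a b → Adjacent a b ⊎ Apart a b
  adjacent? a b with a ≟ k | b ≟ suc k | a ≟ suc k | b ≟ k
  ... | yes x | yes y | _     | _     = inj₁ (inj₁ (x , y))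
  ... | _     | _     | yes x | yes y = inj₁ (inj₂ (x , y))
  ... | yes x | no y  | _     | _     = inj₂ ((λ _ → y) , λ e → ⊥-elim (<-irrefl (trans (sym x) e) (n<1+n k)))
  ... | no x  | _     | yes _ | no y' = inj₂ ((λ e → ⊥-elim (x e)) , λ _ → y')
  ... | no x  | _     | no x' | _     = inj₂ ((λ e → ⊥-elim (x e)) , (λ e → ⊥-elim (x' e)))

  sw-apart : ∀ a b → Apart a b → (sw k a <ᵇ sw k b) ≡ (a <ᵇ b)
  sw-apart a b (x , y) = sw-<ᵇ k a b x y

  ∧-false-l : ∀ {a b} → a ≡ false → (a ∧ b) ≡ false
  ∧-false-l refl = refl

  ∧-false-r : ∀ a {b} → b ≡ false → (a ∧ b) ≡ false
  ∧-false-r false refl = refl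
  ∧-false-r true  refl = refl

  module P (p : ℕ → ℕ) (h1 : k < p k) (h2 : p (suc k) < suc k) (h3 : p k ≢ suc k) (h4 : p (suc k) ≢ k)
           (ck : ∀ x → p x ≡ k → k < x) (ck1 : ∀ x → p x ≡ suc k → x < suc k) where

    pk> : suc k < p k
    pk> = ≤∧≢⇒< h1 (λ e → h3 (sym e))

    pk1< : p (suc k) < k
    pk1< = ≤∧≢⇒< (≤-pred h2) h4

    -- The yy-test of the relabelled tree, read at old names.
    Q : ℕ → ℕ → Bool
    Q i j = (sw k (p j) <ᵇ sw k i) ∧ (sw k i <ᵇ sw k j) ∧ (sw k j <ᵇ sw k (p i))

    -- The pair that disappears.
    δ : ℕ → ℕ → Bool
    δ i j = (i ≡ᵇ k) ∧ (j ≡ᵇ suc k)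

    neither : ∀ i j → yyPair p i j ≡ false → Q i j ≡ false → δ i j ≡ false → 𝟙 (yyPair p i j) ≡ 𝟙 (Q i j) + 𝟙 (δ i j)
    neither i j a b c rewrite a | b | c = refl

    lost-pair : 𝟙 (yyPair p k (suc k)) ≡ 𝟙 (Q k (suc k)) + 𝟙 (δ k (suc k))
    lost-pair = trans (cong 𝟙 old-pair) (sym (cong₂ _+_ (cong 𝟙 not-new-pair) (cong 𝟙 lost)))
      where
      old-pair : yyPair p k (suc k) ≡ true
      old-pair rewrite →<ᵇ pk1< | →<ᵇ (n<1+n k) | →<ᵇ pk> = refl
      not-new-pair : Q k (suc k) ≡ false
      not-new-pair = ∧-false₂ (sw k (p (suc k)) <ᵇ sw k k) (sw k (suc k) <ᵇ sw k (p k))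
                       (trans (cong₂ _<ᵇ_ (sw-k k) (sw-sk k)) (<ᵇ-f (n≤1+n k)))
      lost : δ k (suc k) ≡ true
      lost rewrite ≡ᵇ-refl k = refl

    reversed-pair : 𝟙 (yyPair p (suc k) k) ≡ 𝟙 (Q (suc k) k) + 𝟙 (δ (suc k) k)
    reversed-pair = neither (suc k) k (∧-false₂ (p k <ᵇ suc k) (k <ᵇ p (suc k)) (<ᵇ-f (n≤1+n k)))
       (∧-false₁ (sw k (suc k) <ᵇ sw k k) (sw k k <ᵇ sw k (p (suc k))) (trans (cong₂ _<ᵇ_ (sw-big k (p k) pk>) (sw-sk k)) (<ᵇ-f (<⇒≤ h1))))
       (∧-false-l (≡ᵇ-f (λ e → <-irrefl (sym e) (n<1+n k))))

    parent-j-adjacent : ∀ i j → Apart i j → Adjacent (p j) i → 𝟙 (yyPair p i j) ≡ 𝟙 (Q i j) + 𝟙 (δ i j)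
    parent-j-adjacent i j ap (inj₂ (pj , refl)) = neither i j (∧-false₂ (p j <ᵇ i) (j <ᵇ p i) (<ᵇ-f (<⇒≤ j<k)))
        (∧-false₂ (sw k (p j) <ᵇ sw k i) (sw k j <ᵇ sw k (p i)) (trans (sw-apart i j ap) (<ᵇ-f (<⇒≤ j<k))))
        (∧-false-r (i ≡ᵇ i) (≡ᵇ-f (λ e → <-asym (subst (_< i) e j<k) (n<1+n i))))
      where
      j<k : j < k
      j<k = ≤∧≢⇒< (≤-pred (ck1 j pj)) (λ e → h3 (subst (λ z → p z ≡ suc k) e pj))
    parent-j-adjacent i j ap (inj₁ (pj , refl)) = neither (suc k) j (∧-false₃ (p j <ᵇ suc k) (suc k <ᵇ j) (<ᵇ-f pj≤j))
        (∧-false₃ (sw k (p j) <ᵇ sw k (suc k)) (sw k (suc k) <ᵇ sw k j)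
           (trans (cong₂ _<ᵇ_ (sw-big k j kj) (sw-small k _ pk1<)) (<ᵇ-f pj≤j)))
        (∧-false-l (≡ᵇ-f (λ e → <-irrefl (sym e) (n<1+n k))))
      where
      kj : suc k < j
      kj = ≤∧≢⇒< (ck j pj) (λ e → h4 (subst (λ z → p z ≡ k) (sym e) pj))
      pj≤j : p (suc k) ≤ j
      pj≤j = ≤-trans (<⇒≤ pk1<) (<⇒≤ (<-trans (n<1+n k) kj))

    parent-i-adjacent : ∀ i j → Apart i j → Apart (p j) i → Adjacent j (p i) → 𝟙 (yyPair p i j) ≡ 𝟙 (Q i j) + 𝟙 (δ i j)
    parent-i-adjacent i j ap apj (inj₁ (refl , pi)) = neither i k (∧-false₁ (i <ᵇ k) (k <ᵇ p i) (<ᵇ-f (<⇒≤ (<-trans ik h1))))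
        (∧-false₁ (sw k i <ᵇ sw k k) (sw k k <ᵇ sw k (p i)) (trans (sw-apart (p k) i apj) (<ᵇ-f (<⇒≤ (<-trans ik h1)))))
        (∧-false-r (i ≡ᵇ k) (≡ᵇ-f (λ e → <-irrefl e (n<1+n k))))
      where
      ik : i < k
      ik = ≤∧≢⇒< (≤-pred (ck1 i pi)) (λ e → h3 (subst (λ z → p z ≡ suc k) e pi))
    parent-i-adjacent i j ap apj (inj₂ (refl , pi)) = neither i (suc k) (∧-false₂ (p (suc k) <ᵇ i) (suc k <ᵇ p i) (<ᵇ-f (<⇒≤ ki)))
        (∧-false₂ (sw k (p (suc k)) <ᵇ sw k i) (sw k (suc k) <ᵇ sw k (p i)) (trans (sw-apart i (suc k) ap) (<ᵇ-f (<⇒≤ ki))))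
        (∧-false-l (≡ᵇ-f (λ e → <-irrefl (sym e) (<-trans (n<1+n k) ki))))
      where
      ki : suc k < i
      ki = ≤∧≢⇒< (ck i pi) (λ e → h4 (subst (λ z → p z ≡ k) (sym e) pi))

    all-apart : ∀ i j → Apart i j → Apart (p j) i → Apart j (p i) → 𝟙 (yyPair p i j) ≡ 𝟙 (Q i j) + 𝟙 (δ i j)
    all-apart i j ap apj api rewrite sw-apart (p j) i apj | sw-apart i j ap | sw-apart j (p i) api =
      trans (sym (+-identityʳ _)) (cong (𝟙 (yyPair p i j) +_) (sym (cong 𝟙 not-lost)))
      where
      not-lost : δ i j ≡ false
      not-lost with i ≟ k | j ≟ suc k
      ... | yes a | yes b = ⊥-elim (proj₁ ap a b)
      ... | no a  | _     = ∧-false-l (≡ᵇ-f a)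
      ... | yes a | no b  = trans (cong (_∧ (j ≡ᵇ suc k)) (→≡ᵇ a)) (≡ᵇ-f b)

    split : ∀ i j → 𝟙 (yyPair p i j) ≡ 𝟙 (Q i j) + 𝟙 (δ i j)
    split i j with adjacent? i j
    ... | inj₁ (inj₁ (refl , refl)) = lost-pair
    ... | inj₁ (inj₂ (refl , refl)) = reversed-pair
    ... | inj₂ ap with adjacent? (p j) i
    ...   | inj₁ adj = parent-j-adjacent i j ap adj
    ...   | inj₂ apj with adjacent? j (p i)
    ...     | inj₁ adj = parent-i-adjacent i j ap apj adj
    ...     | inj₂ api = all-apart i j ap apj api

module AdjacentSwap (n k : ℕ) (1≤k : 1 ≤ k) (k+1≤n : suc k ≤ n) where

  open CrossingPairs k

  swF : List ℕ → ℕ → ℕ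
  swF ps v = sw k (par ps (sw k v))

  swapped : List ℕ → List ℕ
  swapped ps = tab (suc n) (swF ps)

  sw-≤ : ∀ x → x ≤ suc n → sw k x ≤ suc n
  sw-≤ x h with swCase k x
  ... | isk refl rewrite sw-k x = ≤-trans k+1≤n (n≤1+n n)
  ... | issk refl rewrite sw-sk k = ≤-trans (n≤1+n k) (≤-trans k+1≤n (n≤1+n n))
  ... | oth a b rewrite sw-o k x a b = h

  k+1≤n+1 : suc k ≤ suc n
  k+1≤n+1 = ≤-trans k+1≤n (n≤1+n n)

  par-swapped : ∀ ps → Shape n ps → ∀ x → par (swapped ps) (sw k x) ≡ sw k (par ps x)
  par-swapped ps v zero = trans (cong (par (swapped ps)) (sw0 k 1≤k)) (sym (sw0 k 1≤k))
  par-swapped ps v (suc x) with suc x ≤? suc n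
  ... | yes le = let (a , b) = sw-range k (suc n) (suc x) 1≤k k+1≤n+1 (s≤s z≤n) le in
    trans (par-tab (suc n) (swF ps) (sw k (suc x)) a b) (cong (λ z → sw k (par ps z)) (sw-sw k (suc x)))
  ... | no nle = let g = ≰⇒> nle
                     big : suc k < suc x
                     big = <-trans (s≤s k+1≤n) g in
    trans (cong (par (swapped ps)) (sw-big k (suc x) big))
     (trans (par-out (swapped ps) (suc x) (subst (_< suc x) (sym (length-tab (suc n) (swF ps))) g))
      (trans (sym (sw0 k 1≤k)) (cong (sw k) (sym (par-out ps (suc x) (subst (_< suc x) (sym (proj₁ v)) g))))))

  shape-swp : ∀ ps → Shape n ps → Shape n (swapped ps)
  shape-swp ps v = length-tab (suc n) (swF ps) , bounded-tab (suc n) _ (swF ps) (λ i _ _ → s≤s (sw-≤ _ (shape-par n ps v (sw k i))))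

  swapped-swapped : ∀ ps → Shape n ps → swapped (swapped ps) ≡ ps
  swapped-swapped ps v = trans (tab-cong (suc n) (swF (swapped ps)) (par ps) (λ i _ _ → trans (cong (sw k) (par-swapped ps v i)) (sw-sw k (par ps i))))
    (trans (cong (λ m → tab m (par ps)) (sym (proj₁ v))) (sym (tab-par ps)))

  -- k and k+1 are unrelated: neither is an ancestor-or-parent of the other.
  -- This is exactly what makes sw k preserve the alternative condition.
  Unrelated : (ℕ → ℕ) → Set
  Unrelated p = p k ≢ suc k × p (suc k) ≢ k × ¬ Reach p (p k) (suc k) × ¬ Reach p (p (suc k)) k

  module Transport (ps : List ℕ) (v : Shape n ps) where
    p = par ps
    p' = par (swapped ps)

    psw : ∀ x → p' (sw k x) ≡ sw k (p x)
    psw = par-swapped ps v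

    iter-sw : ∀ j x → iterF p' j (sw k x) ≡ sw k (iterF p j x)
    iter-sw zero x = refl
    iter-sw (suc j) x = trans (cong p' (iter-sw j x)) (psw (iterF p j x))

    reach⁺ : ∀ {x y} → Reach p x y → Reach p' (sw k x) (sw k y)
    reach⁺ (j , e) = j , trans (iter-sw j _) (cong (sw k) e)

    reach⁻ : ∀ {x y} → Reach p' (sw k x) (sw k y) → Reach p x y
    reach⁻ (j , e) = j , sw-inj k (trans (sym (iter-sw j _)) e)

    sw-range′ : ∀ x → 1 ≤ x → x ≤ suc n → 1 ≤ sw k x × sw k x ≤ suc n
    sw-range′ x a b = sw-range k (suc n) x 1≤k k+1≤n+1 a b

    tree-swap : IsTree n p → IsTree n p'
    tree-swap t x a b = let (c , d) = sw-range′ x a b in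
      subst₂ (Reach p') (sw-sw k x) (sw0 k 1≤k) (reach⁺ (t (sw k x) c d))

    sw-<-apart : ∀ a b → Apart a b → (a < b → sw k a < sw k b) × (sw k a < sw k b → a < b)
    sw-<-apart a b nf = (λ h → <ᵇ→ (trans (sw-apart a b nf) (→<ᵇ h))) , (λ h → <ᵇ→ (trans (sym (sw-apart a b nf)) (→<ᵇ h)))

    apart-parent : Unrelated p → ∀ i → (p i ≡ k → i ≢ suc k) × (p i ≡ suc k → i ≢ k)
    apart-parent (a , b , _ , _) i = (λ e e' → b (trans (cong p (sym e')) e)) , (λ e e' → a (trans (cong p (sym e')) e))

    apart-ancestor : Unrelated p → ∀ d i → Reach p (p d) i → (d ≡ k → i ≢ suc k) × (d ≡ suc k → i ≢ k)
    apart-ancestor (_ , _ , c , d') d i r = (λ { refl refl → c r }) , (λ { refl refl → d' r })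

    -- All comparisons used in the alternative condition involve a vertex and
    -- one of its ancestors, hence are preserved by sw k when k, k+1 are unrelated.
    alt-swap : IsAlternative n p → Unrelated p → IsAlternative n p'
    alt-swap a nr i d i1 i2 d1 d2 r =
      let i0 = sw k i
          d0 = sw k d
          (i01 , i02) = sw-range′ i i1 i2
          (d01 , d02) = sw-range′ d d1 d2
          r0 : Reach p (p d0) i0
          r0 = reach⁻ (subst₂ (Reach p') (trans (cong p' (sym (sw-sw k d))) (psw d0)) (sym (sw-sw k i)) r)
          (c1 , c2) = a i0 d0 i01 i02 d01 d02 r0
          (pi1 , pi2) = sw-<-apart (p i0) i0 (apart-parent nr i0)
          (ip1 , ip2) = sw-<-apart i0 (p i0) ((λ e e' → proj₂ (apart-parent nr i0) e' e) , (λ e e' → proj₁ (apart-parent nr i0) e' e))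
          (di1 , di2) = sw-<-apart d0 i0 (apart-ancestor nr d0 i0 r0)
          (id1 , id2) = sw-<-apart i0 d0 ((λ e e' → proj₂ (apart-ancestor nr d0 i0 r0) e' e) , (λ e e' → proj₁ (apart-ancestor nr d0 i0 r0) e' e))
          pe : p' i ≡ sw k (p i0)
          pe = trans (cong p' (sym (sw-sw k i))) (psw i0)
      in (λ h → subst₂ _<_ (sw-sw k d) (sw-sw k i) (di1 (c1 (pi2 (subst₂ _<_ pe (sym (sw-sw k i)) h)))))
       , (λ h → subst₂ _<_ (sw-sw k i) (sw-sw k d) (id1 (c2 (ip2 (subst₂ _<_ (sym (sw-sw k i)) pe h)))))

    k≤ : k ≤ suc n
    k≤ = ≤-trans (n≤1+n k) k+1≤n+1

    unrelated-10 : IsAlternative n p → k < p k → p (suc k) < suc k → p k ≢ suc k → p (suc k) ≢ k → Unrelated p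
    unrelated-10 a h1 h2 h3 h4 = h3 , h4 , r1 , r2
      where
      r1 : ¬ Reach p (p k) (suc k)
      r1 r = let y = p k
                 (c1 , _) = a (suc k) y (s≤s z≤n) k+1≤n+1 (≤-trans 1≤k (<⇒≤ h1)) (shape-par n ps v k) (Reach-step h3 r)
             in <⇒≱ h1 (≤-pred (c1 h2))
      r2 : ¬ Reach p (p (suc k)) k
      r2 r with p (suc k) ≟ 0
      ... | yes z = let (j , e) = r in <-irrefl (trans (sym (iter-fixed p 0 refl j)) (trans (cong (iterF p j) (sym z)) e)) 1≤k
      ... | no nz = let (_ , c2) = a k (p (suc k)) 1≤k k≤ (n≢0⇒n>0 nz) (shape-par n ps v _) (Reach-step h4 r)
                    in <⇒≱ (c2 h1) (≤-pred h2)

    unrelated-01 : IsAlternative n p → p k < k → suc k < p (suc k) → Unrelated p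
    unrelated-01 a h1 h2 = (λ e → <-asym h1 (subst (k <_) (sym e) (n<1+n k))) , (λ e → <-asym h2 (subst (_< suc k) (sym e) (n<1+n k))) , r1 , r2
      where
      r1 : ¬ Reach p (p k) (suc k)
      r1 r = let (_ , c2) = a (suc k) k (s≤s z≤n) k+1≤n+1 1≤k k≤ r in <-asym (c2 h2) (n<1+n k)
      r2 : ¬ Reach p (p (suc k)) k
      r2 r = let (c1 , _) = a k (suc k) 1≤k k≤ (s≤s z≤n) k+1≤n+1 r in <-asym (c1 h1) (n<1+n k)

    ch-sw : ∀ w → chSum n p' w ≡ chSum n p (sw k w)
    ch-sw w = trans (sym (sum-sw (suc n) k (λ i → 𝟙 (p' i ≡ᵇ w)) 1≤k k+1≤n+1))
      (sum-map-cong _ _ (from1 (suc n)) (λ {i} _ → cong 𝟙 (trans (cong (_≡ᵇ w) (psw i))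
         (trans (cong (sw k (p i) ≡ᵇ_) (sym (sw-sw k w))) (≡ᵇ-inj (sw k) (sw-inj k) (p i) (sw k w))))))

    sw-top : sw k (suc n) ≡ suc n
    sw-top = sw-big k (suc n) (s≤s k+1≤n)

    exc-sw : p k ≢ suc k → p (suc k) ≢ k → ∀ y → (sw k y <ᵇ p' (sw k y)) ≡ (y <ᵇ p y)
    exc-sw h3 h4 y = trans (cong (sw k y <ᵇ_) (psw y)) (sw-<ᵇ k y (p y) (λ { refl e → h3 e }) (λ { refl e → h4 e }))

    childK : IsAlternative n p → k < p k → ∀ x → p x ≡ k → k < x
    childK a h x e = proj₂ (child-side n ps v a k x 1≤k k≤ e) h

    childK1 : IsAlternative n p → p (suc k) < suc k → ∀ x → p x ≡ suc k → x < suc k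
    childK1 a h x e = proj₁ (child-side n ps v a (suc k) x (s≤s z≤n) k+1≤n+1 e) h

    yy-sw : IsAlternative n p → k < p k → p (suc k) < suc k → p k ≢ suc k → p (suc k) ≢ k → yySum n p ≡ suc (yySum n p')
    yy-sw a h1 h2 h3 h4 =
      trans (sum-map-cong _ (λ j → sum (map (λ i → 𝟙 (Q i j)) (from1 n)) + sum (map (λ i → 𝟙 (δ i j)) (from1 n))) (from1 n)
               (λ {j} _ → trans (sum-map-cong _ _ (from1 n) (λ {i} _ → split i j)) (sum-map-+ (λ i → 𝟙 (Q i j)) (λ i → 𝟙 (δ i j)) (from1 n))))
      (trans (sum-map-+ _ _ (from1 n)) (trans (cong₂ _+_ Qpart δpart) (+-comm (yySum n p') 1)))
      where
      open P p h1 h2 h3 h4 (childK a h1) (childK1 a h2)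
      Qpart : sum (map (λ j → sum (map (λ i → 𝟙 (Q i j)) (from1 n))) (from1 n)) ≡ yySum n p'
      Qpart = trans (sum-map-cong _ (λ j → sum (map (λ i → 𝟙 (yyPair p' i (sw k j))) (from1 n))) (from1 n)
                       (λ {j} _ → trans (sum-map-cong _ (λ i → 𝟙 (yyPair p' (sw k i) (sw k j))) (from1 n) (λ {i} _ → cong 𝟙 (qq i j)))
                                    (sum-sw n k (λ i → 𝟙 (yyPair p' i (sw k j))) 1≤k k+1≤n)))
                    (sum-sw n k (λ j → sum (map (λ i → 𝟙 (yyPair p' i j)) (from1 n))) 1≤k k+1≤n)
        where
        qq : ∀ i j → Q i j ≡ yyPair p' (sw k i) (sw k j)
        qq i j rewrite psw i | psw j = refl
      δpart : sum (map (λ j → sum (map (λ i → 𝟙 (δ i j)) (from1 n))) (from1 n)) ≡ 1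
      δpart = trans (sum-map-cong _ (λ j → 𝟙 (j ≡ᵇ suc k)) (from1 n) (λ {j} _ → inner j)) (sum-onehot n (suc k) (s≤s z≤n) k+1≤n)
        where
        inner : ∀ j → sum (map (λ i → 𝟙 (δ i j)) (from1 n)) ≡ 𝟙 (j ≡ᵇ suc k)
        inner j with j ≡ᵇ suc k
        ... | true  = trans (sum-map-cong _ (λ i → 𝟙 (i ≡ᵇ k)) (from1 n) (λ {i} _ → cong 𝟙 (∧-identityʳ (i ≡ᵇ k))))
                            (sum-onehot n k 1≤k (≤-trans (n≤1+n k) k+1≤n))
        ... | false = trans (sum-map-cong _ (λ _ → 0) (from1 n) (λ {i} _ → cong 𝟙 (∧-zeroʳ (i ≡ᵇ k)))) (sum-zeros (from1 n))

-- [0v] = a[v]: in a tree with word 0v, vertex 1 is a leaf hanging from the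
-- root 0 (a parent of 1 other than 0 would be ≥ 2, making 1 an excedance);
-- removing it leaves a tree with word v and one root child less.
module LeadingZero (v : List Bool) where
  m = length v

  module L = LeafInsertion m 1 0 (s≤s z≤n) (s≤s z≤n) z≤n (s≤s z≤n) z≤n (λ ())

  reduce : ∀ i j k → bracket (false ∷ v) i j k ≡ count m v (λ x → suc x ≡ᵇ i) (_≡ᵇ j) (_≡ᵇ k) (λ _ → true)
  reduce i j k = trans (bracket-count (false ∷ v) (suc m) refl i j k) (LM.leaf-count (λ _ → true) leaf-in-tree side-ok (λ _ _ → refl))
    where
    module LM = L.Count [] false v refl refl (_≡ᵇ i) (_≡ᵇ j) (λ x → suc x ≡ᵇ i) (_≡ᵇ j) (_≡ᵇ k) (λ x → refl) (λ x → refl)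
    leaf-in-tree : ∀ ps → Counted (suc m) (false ∷ v) (_≡ᵇ i) (_≡ᵇ j) (_≡ᵇ k) ps → true ≡ true → par ps 1 ≡ 0 × (∀ x → par ps x ≢ 1)
    leaf-in-tree ps g _ = p1 , childless
      where
      open Counted g
      w1 : (1 <ᵇ par ps 1) ≡ false
      w1 = wordAt g 0 (s≤s z≤n)
      p1 : par ps 1 ≡ 0
      p1 with par ps 1 in e
      ... | zero = refl
      ... | suc zero = ⊥-elim (no-fixpoint (suc m) (par ps) tree 1 (s≤s z≤n) (s≤s z≤n) e)
      ... | suc (suc y) = ⊥-elim (false≢true (trans (sym w1) (cong (1 <ᵇ_) e)))
      childless : ∀ x → par ps x ≢ 1
      childless x e = let (a , b) = child-range (suc m) ps shape x 1 e (s≤s z≤n)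
                          (c1 , _) = alt 1 x (s≤s z≤n) (s≤s z≤n) a b (0 , e)
                      in <-irrefl refl (≤-trans (c1 (subst (_< 1) (sym p1) (s≤s z≤n))) a)
    -- The new parent is the root, so there is no side condition.
    side-ok : ∀ ps' → (g : Counted m v (λ x → suc x ≡ᵇ i) (_≡ᵇ j) (_≡ᵇ k) ps') → L.Transport.LeafC ps' (Counted.shape g)
    side-ok ps' g ()

  leading-zero : bracket (false ∷ v) ≈P mulA (bracket v)
  leading-zero zero    j k = trans (reduce 0 j k) (census-empty m v (λ x → suc x ≡ᵇ 0) (_≡ᵇ j) (_≡ᵇ k) (λ ps g → false≢true (Counted.c₀-ok g)))
  leading-zero (suc i) j k = trans (reduce (suc i) j k) (sym (bracket-count v m refl i j k))

-- [u1] = b[u]: symmetrically, in a tree with word u1 the vertex n is a leaf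
-- hanging from the top vertex n+1.
module TrailingOne (u : List Bool) where
  m = length u

  module L = LeafInsertion m (suc m) (suc (suc m)) (s≤s z≤n) ≤-refl ≤-refl (s≤s (≤-trans (n≤1+n m) (n≤1+n (suc m)))) ≤-refl (λ e → <-irrefl (sym e) (n<1+n _))

  len : length (u ++ true ∷ []) ≡ suc m
  len = trans (length-++ u {true ∷ []}) (+-comm m 1)

  q'≡ : L.q' ≡ suc m
  q'≡ = ρ-ge (n≤1+n (suc m))

  reduce : ∀ i j k → bracket (u ++ true ∷ []) i j k ≡ count m u (_≡ᵇ i) (λ x → suc x ≡ᵇ j) (_≡ᵇ k) (λ _ → true)
  reduce i j k = trans (bracket-count (u ++ true ∷ []) (suc m) len i j k)
     (trans (LM.leaf-count (λ _ → true) leaf-in-tree side-ok (λ _ _ → refl)) (cong (λ z → count m z (_≡ᵇ i) (λ x → suc x ≡ᵇ j) (_≡ᵇ k) (λ _ → true)) (++-identityʳ u)))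
    where
    module LM = L.Count u true [] refl (→<ᵇ (n<1+n (suc m))) (_≡ᵇ i) (_≡ᵇ j) (_≡ᵇ i) (λ x → suc x ≡ᵇ j) (_≡ᵇ k) (λ x → refl)
      (λ x → cong (λ z → 𝟙 z + x ≡ᵇ j) (≡ᵇ-refl (suc (suc m))))
    -- Vertex m+1 is a leaf child of m+2: its parent exceeds it, and a child
    -- x of m+1 would have to be m+2 by the alternative condition, forming
    -- a cycle that misses the root.
    leaf-in-tree : ∀ ps → Counted (suc m) (u ++ true ∷ []) (_≡ᵇ i) (_≡ᵇ j) (_≡ᵇ k) ps → true ≡ true → par ps (suc m) ≡ suc (suc m) × (∀ x → par ps x ≢ suc m)
    leaf-in-tree ps g _ = p1 , childless
      where
      open Counted g
      w1 : (suc m <ᵇ par ps (suc m)) ≡ true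
      w1 = trans (wordAt g m ≤-refl) (letter-at u (true ∷ []))
      p1 : par ps (suc m) ≡ suc (suc m)
      p1 = ≤-antisym (shape-par (suc m) ps shape (suc m)) (<ᵇ→ w1)
      childless : ∀ x → par ps x ≢ suc m
      childless x e = let (a , b) = child-range (suc m) ps shape x (suc m) e (s≤s z≤n)
                          (_ , c2) = alt (suc m) x (s≤s z≤n) (n≤1+n (suc m)) a b (0 , e)
                          xe : x ≡ suc (suc m)
                          xe = ≤-antisym b (c2 (<ᵇ→ w1))
                          e' : par ps (suc (suc m)) ≡ suc m
                          e' = subst (λ z → par ps z ≡ suc m) xe e
                          (kk , r) = tree (suc m) (s≤s z≤n) (n≤1+n (suc m))
                      in case (two-cycle (par ps) (suc m) (suc (suc m)) p1 e' kk) r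
        where
        case : ∀ {z} → z ≡ suc m ⊎ z ≡ suc (suc m) → z ≡ 0 → ⊥
        case (inj₁ refl) ()
        case (inj₂ refl) ()
    -- The new parent m+2 is the top vertex; the leaf m+1 lies below it.
    side-ok : ∀ ps' → (g : Counted m (u ++ []) (_≡ᵇ i) (λ x → suc x ≡ᵇ j) (_≡ᵇ k) ps') → L.Transport.LeafC ps' (Counted.shape g)
    side-ok ps' g _ rewrite q'≡ | σ-ge {suc m} {suc m} ≤-refl =
      (λ _ → n<1+n _) , (λ h → ⊥-elim (<⇒≱ h (shape-par m ps' (Counted.shape g) (suc m))))

  trailing-one : bracket (u ++ true ∷ []) ≈P mulB (bracket u)
  trailing-one i zero    k = trans (reduce i 0 k) (census-empty m u (_≡ᵇ i) (λ x → suc x ≡ᵇ 0) (_≡ᵇ k) (λ ps g → false≢true (Counted.c₁-ok g)))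
  trailing-one i (suc j) k = trans (reduce i (suc j) k) (sym (bracket-count u m refl i j k))

-- With k = |u|+1 the letters at k and
-- k+1 are 1 and 0.  Split the trees into three classes:
--   (A) p(k) = k+1: k is a leaf; deleting it gives a tree with word u0v;
--   (B) otherwise p(k+1) = k: k+1 is a leaf; deleting it gives word u1v;
--   (C) otherwise k, k+1 are unrelated and exchanging them gives a tree
--       with word u01v and one yy-pair less.
module Commutation (u v : List Bool) where
  a = length u
  M = a + suc (length v)
  k = suc a
  η = u ++ true ∷ false ∷ v
  ηA = u ++ false ∷ v
  ηB = u ++ true ∷ v
  ηC = u ++ false ∷ true ∷ v

  len : length η ≡ suc M
  len = trans (length-++ u {true ∷ false ∷ v}) (+-suc a (suc (length v)))
  lenA : length ηA ≡ M
  lenA = length-++ u {false ∷ v}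
  lenB : length ηB ≡ M
  lenB = length-++ u {true ∷ v}
  lenC : length ηC ≡ suc M
  lenC = trans (length-++ u {false ∷ true ∷ v}) (+-suc a (suc (length v)))

  kM : k ≤ M
  kM = subst (k ≤_) (sym (+-suc a (length v))) (s≤s (m≤m+n a (length v)))
  1≤k : 1 ≤ k
  1≤k = s≤s z≤n
  k+1≤n : suc k ≤ suc M
  k+1≤n = s≤s kM
  kS : k ≤ suc M
  kS = ≤-trans kM (n≤1+n M)
  kSS : k ≤ suc (suc M)
  kSS = ≤-trans kS (n≤1+n _)
  skSS : suc k ≤ suc (suc M)
  skSS = ≤-trans k+1≤n (n≤1+n _)
  kne : ∀ {x} → x ≤ suc M → x ≢ suc (suc M)
  kne l e = <-irrefl e (s≤s l)

  classA : List ℕ → Bool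
  classA ps = par ps k ≡ᵇ suc k
  classB : List ℕ → Bool
  classB ps = par ps (suc k) ≡ᵇ k

  module CaseA (i j K : ℕ) where

    module L = LeafInsertion M k (suc k) 1≤k (≤-trans kM (n≤1+n M)) (s≤s (≤-trans kM (n≤1+n M))) (≤-trans (n≤1+n k) (n≤1+n _)) ≤-refl (λ e → <-irrefl (sym e) (n<1+n k))
    module LM = L.Count u true (false ∷ v) refl (→<ᵇ (n<1+n k)) (_≡ᵇ i) (_≡ᵇ j) (_≡ᵇ i) (_≡ᵇ j) (_≡ᵇ K) (λ x → refl)
      (λ x → cong (λ z → 𝟙 z + x ≡ᵇ j) (≡ᵇ-f (kne k+1≤n)))

    -- k is a leaf: a child x of k would lie above k and, being a grandchild
    -- of the non-excedance k+1, below k.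
    leaf-in-tree : ∀ ps → Counted (suc M) η (_≡ᵇ i) (_≡ᵇ j) (_≡ᵇ K) ps → classA ps ≡ true → par ps k ≡ suc k × (∀ x → par ps x ≢ k)
    leaf-in-tree ps g e = pk , childless
      where
      open Counted g
      pk : par ps k ≡ suc k
      pk = ≡ᵇ→ e
      w2 : (suc k <ᵇ par ps (suc k)) ≡ false
      w2 = trans (wordAt g k (s≤s kM)) (letter-at1 u true false v)
      h2 : par ps (suc k) < suc k
      h2 = non-excedance (suc M) (par ps) (suc k) tree (s≤s z≤n) skSS w2
      childless : ∀ x → par ps x ≢ k
      childless x e = let (a1 , b1) = child-range (suc M) ps shape x k e 1≤k
                          (_ , c2) = alt k x 1≤k kSS a1 b1 (0 , e)
                          (c1' , _) = alt (suc k) x (s≤s z≤n) skSS a1 b1 (1 , trans (cong (par ps) e) pk)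
                      in <⇒≱ (c2 (subst (k <_) (sym pk) (n<1+n k))) (≤-pred (c1' h2))

    -- In the reduced tree the old vertex k (the new parent) is not an excedance.
    side-ok : ∀ ps' → (g : Counted M ηA (_≡ᵇ i) (_≡ᵇ j) (_≡ᵇ K) ps') → L.Transport.LeafC ps' (Counted.shape g)
    side-ok ps' g _ rewrite ρ-ge {k} {suc k} (n≤1+n k) | σ-ge {k} {k} ≤-refl =
      (λ _ → n<1+n k) , (λ h → ⊥-elim (false≢true (trans (sym (trans (wordAt g a kM) (letter-at u (false ∷ v)))) (→<ᵇ h))))

    inserted-in-class : ∀ ps' → Counted M ηA (_≡ᵇ i) (_≡ᵇ j) (_≡ᵇ K) ps' → classA (L.ins ps') ≡ true
    inserted-in-class ps' g = →≡ᵇ (L.par-ins-ℓ ps')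

    class-size : count (suc M) η (_≡ᵇ i) (_≡ᵇ j) (_≡ᵇ K) classA ≡ bracket ηA i j K
    class-size = trans (LM.leaf-count classA leaf-in-tree side-ok inserted-in-class) (sym (bracket-count ηA M lenA i j K))

  ub = u ++ true ∷ []
  eη : ub ++ false ∷ v ≡ η
  eη = ++-assoc u (true ∷ []) (false ∷ v)
  eηB : ub ++ v ≡ ηB
  eηB = ++-assoc u (true ∷ []) v
  lub : suc k ≡ suc (length ub)
  lub = cong suc (sym (trans (length-++ u {true ∷ []}) (+-comm a 1)))

  classB′ : List ℕ → Bool
  classB′ ps = not (classA ps) ∧ classB ps

  -- Class (B); the word is regrouped as (u1)0v so that k+1 follows u1.
  module CaseB (i j K : ℕ) where

    module L = LeafInsertion M (suc k) k (s≤s z≤n) k+1≤n kSS ≤-refl (≤-trans (n≤1+n k) (n≤1+n _)) (λ e → <-irrefl e (n<1+n k))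
    module LM = L.Count ub false v lub (<ᵇ-f (n≤1+n k)) (_≡ᵇ i) (_≡ᵇ j) (_≡ᵇ i) (_≡ᵇ j) (_≡ᵇ K) (λ x → refl)
      (λ x → cong (λ z → 𝟙 z + x ≡ᵇ j) (≡ᵇ-f (kne kS)))

    -- k+1 is a leaf: a child x of k+1 would lie below k+1 and, being a
    -- grandchild of the excedance k, above k.
    leaf-in-tree : ∀ ps → Counted (suc M) (ub ++ false ∷ v) (_≡ᵇ i) (_≡ᵇ j) (_≡ᵇ K) ps → classB′ ps ≡ true → par ps (suc k) ≡ k × (∀ x → par ps x ≢ suc k)
    leaf-in-tree ps g0' e = pk , childless
      where
      g = subst (λ z → Counted (suc M) z (_≡ᵇ i) (_≡ᵇ j) (_≡ᵇ K) ps) eη g0'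
      open Counted g
      pk : par ps (suc k) ≡ k
      pk = ≡ᵇ→ (proj₂ (∧-split e))
      w1 : (k <ᵇ par ps k) ≡ true
      w1 = trans (wordAt g a (≤-trans kM (n≤1+n M))) (letter-at u (true ∷ false ∷ v))
      childless : ∀ x → par ps x ≢ suc k
      childless x e = let (a1 , b1) = child-range (suc M) ps shape x (suc k) e (s≤s z≤n)
                          (c1 , _) = alt (suc k) x (s≤s z≤n) skSS a1 b1 (0 , e)
                          (_ , c2) = alt k x 1≤k kSS a1 b1 (1 , trans (cong (par ps) e) pk)
                      in <⇒≱ (c2 (<ᵇ→ w1)) (≤-pred (c1 (subst (_< suc k) (sym pk) (n<1+n k))))

    -- In the reduced tree the old vertex k (the new parent) is an excedance.
    side-ok : ∀ ps' → (g : Counted M (ub ++ v) (_≡ᵇ i) (_≡ᵇ j) (_≡ᵇ K) ps') → L.Transport.LeafC ps' (Counted.shape g)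
    side-ok ps' g _ rewrite ρ-lt {suc k} {k} (n<1+n k) | σ-lt {suc k} {k} (n<1+n k) =
      (λ h → ⊥-elim (<-asym h (<ᵇ→ w1))) , (λ _ → n<1+n k)
      where
      g' = subst (λ z → Counted M z (_≡ᵇ i) (_≡ᵇ j) (_≡ᵇ K) ps') eηB g
      w1 : (k <ᵇ par ps' k) ≡ true
      w1 = trans (wordAt g' a kM) (letter-at u (true ∷ v))

    inserted-in-class : ∀ ps' → Counted M (ub ++ v) (_≡ᵇ i) (_≡ᵇ j) (_≡ᵇ K) ps' → classB′ (L.ins ps') ≡ true
    inserted-in-class ps' g = ∧-join nA (→≡ᵇ (L.par-ins-ℓ ps'))
      where
      v' = Counted.shape g
      nA : not (classA (L.ins ps')) ≡ true
      nA rewrite ≡ᵇ-f {par (L.ins ps') k} {suc k}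
          (λ e → σ-ne (suc k) (par ps' k) (trans (sym (L.par-ins-σ ps' v' k)) (trans (cong (par (L.ins ps')) (σ-lt (n<1+n k))) e))) = refl

    class-size : count (suc M) η (_≡ᵇ i) (_≡ᵇ j) (_≡ᵇ K) classB′ ≡ bracket ηB i j K
    class-size = trans (cong (λ z → count (suc M) z (_≡ᵇ i) (_≡ᵇ j) (_≡ᵇ K) classB′) (sym eη))
      (trans (LM.leaf-count classB′ leaf-in-tree side-ok inserted-in-class)
       (trans (cong (λ z → count M z (_≡ᵇ i) (_≡ᵇ j) (_≡ᵇ K) (λ _ → true)) eηB)
        (sym (bracket-count ηB M lenB i j K))))

  classC : List ℕ → Bool
  classC ps = not (classA ps) ∧ not (classB ps)

  module CaseC (i j K : ℕ) where

    module S = AdjacentSwap (suc M) k 1≤k k+1≤n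

    Counted₁₀ = Counted (suc M) η (_≡ᵇ i) (_≡ᵇ j) (_≡ᵇ K)
    Counted₀₁ = Counted (suc M) ηC (_≡ᵇ i) (_≡ᵇ j) (λ y → suc y ≡ᵇ K)

    nots : ∀ ps → classC ps ≡ true → par ps k ≢ suc k × par ps (suc k) ≢ k
    nots ps e = let (x , y) = ∧-split e in ≡ᵇ-false⇒≢ (not-true x) , ≡ᵇ-false⇒≢ (not-true y)

    to01 : ∀ ps → Counted₁₀ ps → classC ps ≡ true → Counted₀₁ (S.swapped ps) × true ≡ true × S.swapped (S.swapped ps) ≡ ps
    to01 ps g e = record
      { shape = S.shape-swp ps shape
      ; tree = tree-swap tree
      ; alt = alt-swap alt (unrelated-10 alt h1 h2 nA nB)
      ; word = word-sw (λ x → x <ᵇ p x) (λ x → x <ᵇ p' x) (suc M) u true false v k+1≤n (exc-sw nA nB) word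
      ; c₀-ok = trans (cong (_≡ᵇ i) (trans (ch-sw 0) (cong (chSum (suc M) p) (sw0 k 1≤k)))) c₀-ok
      ; c₁-ok = trans (cong (_≡ᵇ j) (trans (ch-sw (suc (suc M))) (cong (chSum (suc M) p) sw-top))) c₁-ok
      ; yy-ok = trans (cong (_≡ᵇ K) (sym (yy-sw alt h1 h2 nA nB))) yy-ok
      } , refl , S.swapped-swapped ps shape
      where
      open Counted g
      open S.Transport ps shape
      nA = proj₁ (nots ps e)
      nB = proj₂ (nots ps e)
      h1 : k < p k
      h1 = <ᵇ→ (trans (wordAt g a kS) (letter-at u (true ∷ false ∷ v)))
      h2 : p (suc k) < suc k
      h2 = non-excedance (suc M) p (suc k) tree (s≤s z≤n) skSS (trans (wordAt g k k+1≤n) (letter-at1 u true false v))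

    module From01 (ps : List ℕ) (g : Counted₀₁ ps) where
      open Counted g
      open S.Transport ps shape
      h1 : p k < k
      h1 = non-excedance (suc M) p k tree 1≤k kSS (trans (wordAt g a kS) (letter-at u (false ∷ true ∷ v)))
      h2 : suc k < p (suc k)
      h2 = <ᵇ→ (trans (wordAt g k k+1≤n) (letter-at1 u false true v))
      nA : p k ≢ suc k
      nA e = <-asym h1 (subst (k <_) (sym e) (n<1+n k))
      nB : p (suc k) ≢ k
      nB e = <-asym h2 (subst (_< suc k) (sym e) (n<1+n k))
      Tt = S.swapped ps
      vT = S.shape-swp ps shape
      pTk : par Tt k ≡ p (suc k)
      pTk = trans (cong (par Tt) (sym (sw-sk k))) (trans (psw (suc k)) (sw-big k _ h2))
      pTk1 : par Tt (suc k) ≡ p k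
      pTk1 = trans (cong (par Tt) (sym (sw-k k))) (trans (psw k) (sw-small k _ h1))
      nAT : par Tt k ≢ suc k
      nAT e = <-irrefl (trans (sym e) pTk) h2
      nBT : par Tt (suc k) ≢ k
      nBT e = <-irrefl (trans (sym pTk1) e) h1
      alT : IsAlternative (suc M) (par Tt)
      alT = alt-swap alt (unrelated-01 alt h1 h2)
      yyT : yySum (suc M) (par Tt) ≡ suc (yySum (suc M) p)
      yyT = trans (S.Transport.yy-sw Tt vT alT (subst (k <_) (sym pTk) (<-trans (n<1+n k) h2))
                     (subst (_< suc k) (sym pTk1) (<-trans h1 (n<1+n k))) nAT nBT)
                  (cong (λ z → suc (yySum (suc M) (par z))) (S.swapped-swapped ps shape))
      counted : Counted₁₀ Tt
      counted = record
        { shape = vT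
        ; tree = tree-swap tree
        ; alt = alT
        ; word = word-sw (λ x → x <ᵇ p x) (λ x → x <ᵇ par Tt x) (suc M) u false true v k+1≤n (exc-sw nA nB) word
        ; c₀-ok = trans (cong (_≡ᵇ i) (trans (ch-sw 0) (cong (chSum (suc M) p) (sw0 k 1≤k)))) c₀-ok
        ; c₁-ok = trans (cong (_≡ᵇ j) (trans (ch-sw (suc (suc M))) (cong (chSum (suc M) p) sw-top))) c₁-ok
        ; yy-ok = trans (cong (_≡ᵇ K) yyT) yy-ok
        }
      in-class-C : classC Tt ≡ true
      in-class-C = ∧-join (cong not (≡ᵇ-f nAT)) (cong not (≡ᵇ-f nBT))

    from01 : ∀ ps → Counted₀₁ ps → true ≡ true → Counted₁₀ (S.swapped ps) × classC (S.swapped ps) ≡ true × S.swapped (S.swapped ps) ≡ ps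
    from01 ps g _ = From01.counted ps g , From01.in-class-C ps g , S.swapped-swapped ps (Counted.shape g)

    class-size : count (suc M) η (_≡ᵇ i) (_≡ᵇ j) (_≡ᵇ K) classC ≡ count (suc M) ηC (_≡ᵇ i) (_≡ᵇ j) (λ y → suc y ≡ᵇ K) (λ _ → true)
    class-size = count-good (suc M) η (_≡ᵇ i) (_≡ᵇ j) (_≡ᵇ K) classC (suc M) ηC (_≡ᵇ i) (_≡ᵇ j) (λ y → suc y ≡ᵇ K) (λ _ → true) S.swapped S.swapped to01 from01

  shift-yy : ∀ i j K → count (suc M) ηC (_≡ᵇ i) (_≡ᵇ j) (λ y → suc y ≡ᵇ K) (λ _ → true) ≡ mulQ (bracket ηC) i j K
  shift-yy i j zero    = census-empty (suc M) ηC (_≡ᵇ i) (_≡ᵇ j) (λ y → suc y ≡ᵇ 0) (λ ps g → false≢true (Counted.yy-ok g))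
  shift-yy i j (suc K) = sym (bracket-count ηC (suc M) lenC i j K)

  commutation : bracket η ≈P mulQ (bracket ηC) +P bracket ηB +P bracket ηA
  commutation i j K = begin
    bracket η i j K
      ≡⟨ bracket≡ η (suc M) len i j K ⟩
    length (filterᵇ O V)
      ≡⟨ count-split O classA V ⟩
    size classA + length (filterᵇ (λ x → O x ∧ not (classA x)) V)
      ≡⟨ cong (size classA +_) (count-split (λ x → O x ∧ not (classA x)) classB V) ⟩
    size classA + (length (filterᵇ (λ x → (O x ∧ not (classA x)) ∧ classB x) V)
               + length (filterᵇ (λ x → (O x ∧ not (classA x)) ∧ not (classB x)) V))
      ≡⟨ cong₂ (λ x y → size classA + (x + y)) (reassoc classB) (reassoc (λ x → not (classB x))) ⟩
    size classA + (size classB′ + size classC)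
      ≡⟨ cong₂ (λ x y → x + (y + size classC)) (CaseA.class-size i j K) (CaseB.class-size i j K) ⟩
    bracket ηA i j K + (bracket ηB i j K + size classC)
      ≡⟨ cong (λ y → bracket ηA i j K + (bracket ηB i j K + y)) (trans (CaseC.class-size i j K) (shift-yy i j K)) ⟩
    bracket ηA i j K + (bracket ηB i j K + mulQ (bracket ηC) i j K)
      ≡⟨ +-comm (bracket ηA i j K) _ ⟩
    bracket ηB i j K + mulQ (bracket ηC) i j K + bracket ηA i j K
      ≡⟨ cong (_+ bracket ηA i j K) (+-comm (bracket ηB i j K) _) ⟩
    mulQ (bracket ηC) i j K + bracket ηB i j K + bracket ηA i j K
      ∎
    where
    open ≡-Reasoning
    O = Ok (suc M) η (_≡ᵇ i) (_≡ᵇ j) (_≡ᵇ K)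
    size : (List ℕ → Bool) → ℕ
    size E = count (suc M) η (_≡ᵇ i) (_≡ᵇ j) (_≡ᵇ K) E
    V = vecs (suc (suc M)) (suc M + 2)
    reassoc : ∀ (C : List ℕ → Bool) → length (filterᵇ (λ x → (O x ∧ not (classA x)) ∧ C x) V) ≡ length (filterᵇ (λ x → O x ∧ (not (classA x) ∧ C x)) V)
    reassoc C = count-cong _ _ V (λ {x} _ → ∧-assoc (O x) _ _)

theorem3p3 : ((u v : List Bool) → bracket (u ++ true ∷ false ∷ v) ≈P mulQ (bracket (u ++ false ∷ true ∷ v)) +P bracket (u ++ true ∷ v) +P bracket (u ++ false ∷ v))
    × ((v : List Bool) → bracket (false ∷ v) ≈P mulA (bracket v))
    × ((u : List Bool) → bracket (u ++ true ∷ []) ≈P mulB (bracket u))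
theorem3p3 = Commutation.commutation , LeadingZero.leading-zero , TrailingOne.trailing-one
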